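{- Let $A=(a_{i,j})$ be any $r\times r$ symmetrisable generalised Cartan matrix and $S=\mathbb{Z}_{>0}$. If $f\in\mathrm{Frieze}(A,S)$ is unitary, then $p_{A,S}(f)\in\mathrm{YFrieze}(A,S)$ is unitary, where $p_{A,S}(f)(i,m)=\prod_{j=i+1}^r f(j,m)^{ -a_{j,i}}\prod_{j=1}^{i-1} f(j,m+1)^{ -a_{j,i}}$.
   Context: A symmetrisable generalised Cartan matrix is an integer matrix $A=(a_{i,j})$ with $a_{i,i}=2$, $a_{i,j}\le0$ for $i\ne j$, $a_{i,j}=0$ iff $a_{j,i}=0$, and $DA$ symmetric for some positive diagonal $D$. A $\mathbb{Z}_{>0}$-valued frieze pattern (arithmetic frieze pattern) associated to $A$ is a map $f:[1,r]\times\mathbb{Z}\to\mathbb{Z}_{>0}$ with $f(i,m)f(i,m+1)=1+\prod_{j>i} f(j,m)^{ -a_{j,i}}\prod_{j<i}f(j,m+1)^{ -a_{j,i}}$ for all $(i,m)$; a $\mathbb{Z}_{>0}$-valued $\mathbf{Y}$-frieze pattern is a map $k:[1,r]\times\mathbb{Z}\to\mathbb{Z}_{>0}$ with $k(i,m)k(i,m+1)=\prod_{j>i}(1+k(j,m))^{ -a_{j,i}}\prod_{j<i}(1+k(j,m+1))^{ -a_{j,i}}$ for all $(i,m)$. $\mathrm{Frieze}(A,S)$, $\mathrm{YFrieze}(A,S)$ denote these sets. Cluster setup. A mutation matrix is a skew-symmetrisable $r\times r$ integer matrix; its mutation in direction $k$ is $\mu_k(B)=(b'_{i,j})$ with $b'_{i,j}=-b_{i,j}$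 if $i=k$ or $j=k$, and $b'_{i,j}=b_{i,j}+[b_{i,k}]_+[b_{k,j}]_+-[-b_{i,k}]_+[-b_{k,j}]_+$ otherwise ($[a]_+=\max(a,0)$). Let $\mathbb{T}_r$ be the $r$-regular tree with edges at each vertex labelled bijectively by $[1,r]$, with root $t_0$. Let $B=B_A$ be the matrix with $(B_A)_{i,j}=a_{i,j}$ for $i<j$, $(B_A)_{i,j}=-a_{i,j}$ for $i>j$, and $0$ on the diagonal. Let $\{B_t\}$ be the matrix pattern with $B_{t_0}=B$ and $B_{t'}=\mu_k(B_t)$ whenever $t,t'$ are joined by an edge labelled $k$. An $\mathbf{A}$-pattern is an assignment of $r$-tuples $\mathbf{x}_t=(x_{t;1},\dots,x_{t;r})$ of free generators of a rational function field in $r$ variables over $\mathbb{Q}$ such that, for an edge $t$—$t'$ labelled $k$, $\mathbf{x}_{t'}$ agrees with $\mathbf{x}_t$ except $x_{t';k}=\big(\prod_j x_{t;j}^{[b_{j,k}]_+}+\prod_j x_{t;j}^{[-b_{j,k}]_+}\big)/x_{t;k}$, where $(b_{j,k})=B_t$. A $\mathbf{Y}$-pattern is an assignment of $r$-tuples $\mathbf{y}_t$ of free generators of another rational function field with $y_{t';k}=y_{t;k}^{ -1}$ and $y_{t';j}=y_{t;j}y_{t;k}^{[b_{k,j}]_+}(1+y_{t;k})^{ -b_{k,j}}$ for $j\ne k$, $(b_{i,j})=B_t$. The tuples $\mathbf{x}_t$ are the clusters and $\mathbf{y}_t$ the $\mathbf{Y}$-clusters. Define vertices $t(i,m)$, $(i,m)\in[1,r]\times\mathbb{Z}$,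 by $t(1,0)=t_0$, $t(i,m)$ and $t(i+1,m)$ joined by the edge labelled $i$ ($i<r$), and $t(r,m)$ and $t(1,m+1)$ joined by the edge labelled $r$. Set $x(i,m)=x_{t(i,m);i}$ and $y(i,m)=y_{t(i,m);i}$. For every vertex $t$, each $x(i,m)$ is a Laurent polynomial in $\mathbf{x}_t$ and each $y(i,m)$ is a Laurent polynomial in $\mathbf{y}_t$ (with integer coefficients). For a cluster $\mathbf{x}$ let $\psi_{\mathbf{x}}:\mathbb{Z}[\mathbf{x}^{\pm1}]\to\mathbb{Z}$ be the ring homomorphism sending each variable of $\mathbf{x}$ to $1$; similarly $\phi_{\mathbf{y}}$ for a $\mathbf{Y}$-cluster $\mathbf{y}$. An arithmetic frieze pattern $f$ is unitary if there is a cluster $\mathbf{x}$ with $f(i,m)=\psi_{\mathbf{x}}(x(i,m))$ for all $(i,m)$; an arithmetic $\mathbf{Y}$-frieze pattern $k$ is unitary if there is a $\mathbf{Y}$-cluster $\mathbf{y}$ with $k(i,m)=\phi_{\mathbf{y}}(y(i,m))$ for all $(i,m)$ (these maps are indeed arithmetic frieze / $\mathbf{Y}$-frieze patterns). -}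

module Defs where

open import Data.Bool using (Bool; true; false; if_then_else_)
open import Data.Nat as ℕ using (ℕ; zero; suc; _<ᵇ_)
open import Data.Integer as ℤ using (ℤ; +_; -[1+_]; +[1+_])
open import Data.Rational as ℚ using (ℚ; mkℚ; 0ℚ; 1ℚ)
open import Data.Fin as Fin using (Fin; toℕ)
open import Data.List as List using (List; []; _∷_; _++_; reverse; take; drop; concat; replicate; foldl)
open import Data.List.Relation.Unary.Linked using (Linked)
open import Data.Product using (Σ; ∃-syntax; _×_; _,_; proj₁; proj₂)
open import Relation.Binary.PropositionalEquality using (_≡_; _≢_)
open import Relation.Nullary using (does)
open import Function using (_∘_; _⇔_)

-- Symmetrisable generalised Cartan matrices (indices 1..r ↦ Fin r)

record IsSymGCM (r : ℕ) (A : Fin r → Fin r → ℤ) : Set where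
  field
    diag          : ∀ i → A i i ≡ + 2
    offdiag       : ∀ i j → i ≢ j → A i j ℤ.≤ + 0
    zero-iff      : ∀ i j → (A i j ≡ + 0) ⇔ (A j i ≡ + 0)
    symmetrisable : Σ (Fin r → ℕ) λ d → ((∀ i → 0 ℕ.< d i) × (∀ i j → + d i ℤ.* A i j ≡ + d j ℤ.* A j i))

prodℕ : ∀ {n} → (Fin n → ℕ) → ℕ
prodℕ {zero}  g = 1
prodℕ {suc n} g = g Fin.zero ℕ.* prodℕ (g ∘ Fin.suc)

prodℚ : ∀ {n} → (Fin n → ℚ) → ℚ
prodℚ {zero}  g = 1ℚ
prodℚ {suc n} g = g Fin.zero ℚ.* prodℚ (g ∘ Fin.suc)

-- ∏_{j>i} g(j)^{-a_{j,i}} ∏_{j<i} h(j)^{-a_{j,i}}  (for j ≠ i, -a_{j,i} = ∣a_{j,i}∣ ≥ 0)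
twoProd : ∀ {r} → (Fin r → Fin r → ℤ) → (Fin r → ℕ) → (Fin r → ℕ) → Fin r → ℕ
twoProd A g h i = prodℕ λ j →
  if toℕ i <ᵇ toℕ j then g j ℕ.^ ℤ.∣ A j i ∣
  else if toℕ j <ᵇ toℕ i then h j ℕ.^ ℤ.∣ A j i ∣
  else 1

-- Arithmetic (ℤ_{>0}-valued) frieze patterns and Y-frieze patterns
-- A map [1,r] × ℤ → ℤ_{>0} is a map Fin r → ℤ → ℕ with positive values.

Positive : ∀ {r} → (Fin r → ℤ → ℕ) → Set
Positive f = ∀ i m → 0 ℕ.< f i m

IsFrieze : ∀ {r} → (Fin r → Fin r → ℤ) → (Fin r → ℤ → ℕ) → Set
IsFrieze A f = Positive f ×
  (∀ i m → f i m ℕ.* f i (m ℤ.+ + 1)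
           ≡ 1 ℕ.+ twoProd A (λ j → f j m) (λ j → f j (m ℤ.+ + 1)) i)

IsYFrieze : ∀ {r} → (Fin r → Fin r → ℤ) → (Fin r → ℤ → ℕ) → Set
IsYFrieze A k = Positive k ×
  (∀ i m → k i m ℕ.* k i (m ℤ.+ + 1)
           ≡ twoProd A (λ j → 1 ℕ.+ k j m) (λ j → 1 ℕ.+ k j (m ℤ.+ + 1)) i)

pAS : ∀ {r} → (Fin r → Fin r → ℤ) → (Fin r → ℤ → ℕ) → (Fin r → ℤ → ℕ)
pAS A f i m = twoProd A (λ j → f j m) (λ j → f j (m ℤ.+ + 1)) i

Mat : ℕ → Set
Mat r = Fin r → Fin r → ℤ

BA : ∀ {r} → Mat r → Mat r
BA A i j =
  if toℕ i <ᵇ toℕ j then A i j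
  else if toℕ j <ᵇ toℕ i then ℤ.- A i j
  else + 0

[_]₊ : ℤ → ℕ
[ + n ]₊     = n
[ -[1+ n ] ]₊ = 0

μB : ∀ {r} → Fin r → Mat r → Mat r
μB k B i j =
  if does (i Fin.≟ k) then ℤ.- B i j
  else if does (j Fin.≟ k) then ℤ.- B i j
  else B i j ℤ.+ + ([ B i k ]₊ ℕ.* [ B k j ]₊)
             ℤ.- + ([ ℤ.- B i k ]₊ ℕ.* [ ℤ.- B k j ]₊)

-- Arithmetic in ℚ needed to evaluate (subtraction-free) exchange relations.
-- inv is the reciprocal on nonzero rationals (all values occurring below
-- are positive); it is set to 0 at 0 only to make it total.

inv : ℚ → ℚ
inv (mkℚ (+ zero) _ _) = 0ℚ
inv q@(mkℚ +[1+ n ] _ _) = ℚ.1/ q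
inv q@(mkℚ -[1+ n ] _ _) = ℚ.1/ q

powℕ : ℚ → ℕ → ℚ
powℕ q zero    = 1ℚ
powℕ q (suc n) = q ℚ.* powℕ q n

powℤ : ℚ → ℤ → ℚ
powℤ q (+ n)      = powℕ q n
powℤ q -[1+ n ]   = inv (powℕ q (suc n))

-- Seeds specialised at numerical values: (mutation matrix, values)

Seed : ℕ → Set
Seed r = Mat r × (Fin r → ℚ)

μA : ∀ {r} → Fin r → Seed r → Seed r
μA k (B , x) = μB k B , λ j →
  if does (j Fin.≟ k)
  then (prodℚ (λ l → powℕ (x l) [ B l k ]₊) ℚ.+ prodℚ (λ l → powℕ (x l) [ ℤ.- B l k ]₊))
       ℚ.* inv (x k)
  else x j

μY : ∀ {r} → Fin r → Seed r → Seed r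
μY k (B , y) = μB k B , λ j →
  if does (j Fin.≟ k)
  then inv (y k)
  else y j ℚ.* powℕ (y k) [ B k j ]₊ ℚ.* powℤ (1ℚ ℚ.+ y k) (ℤ.- B k j)

mutAlong : ∀ {r} → (Fin r → Seed r → Seed r) → List (Fin r) → Seed r → Seed r
mutAlong μ w s = foldl (λ s' k → μ k s') s w

-- The r-regular tree T_r: vertices = reduced words (no two consecutive
-- equal labels) in the labels Fin r, read from the root t₀.

Reduced : ∀ {r} → List (Fin r) → Set
Reduced = Linked _≢_

-- the word from t₀ = t(1,0) to t(i,m)
-- m ≥ 0 : labels (1 2 … r)^m 1 2 … i-1
-- m < 0 : labels (r r-1 … 1)^{-m-1} r r-1 … i
pathTo : ∀ {r} → Fin r → ℤ → List (Fin r)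
pathTo {r} i (+ n)    = concat (replicate n (List.allFin r)) ++ take (toℕ i) (List.allFin r)
pathTo {r} i -[1+ n ] = concat (replicate n (reverse (List.allFin r)))
                        ++ reverse (drop (toℕ i) (List.allFin r))

matAt : ∀ {r} → Mat r → List (Fin r) → Mat r
matAt B w = foldl (λ B' k → μB k B') B w

allOne : ∀ {r} → Fin r → ℚ
allOne _ = 1ℚ

-- ψ_{x_t}(x(i,m)): the cluster variable x(i,m), as a rational function
-- of the cluster x_t at vertex t, evaluated at x_t = (1,…,1); obtained by
-- evaluating the exchange relations along the path t → t₀ → t(i,m).
ψx : ∀ {r} → Mat r → List (Fin r) → Fin r → ℤ → ℚ
ψx B t i m = proj₂ (mutAlong μA (reverse t List.++ pathTo i m) (matAt B t , allOne)) i

φy : ∀ {r} → Mat r → List (Fin r) → Fin r → ℤ → ℚ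
φy B t i m = proj₂ (mutAlong μY (reverse t List.++ pathTo i m) (matAt B t , allOne)) i

UnitaryFrieze : ∀ {r} → Mat r → (Fin r → ℤ → ℕ) → Set
UnitaryFrieze A f = ∃[ t ] (Reduced t × (∀ i m → ψx (BA A) t i m ≡ (+ f i m) ℚ./ 1))

UnitaryYFrieze : ∀ {r} → Mat r → (Fin r → ℤ → ℕ) → Set
UnitaryYFrieze A k = ∃[ t ] (Reduced t × (∀ i m → φy (BA A) t i m ≡ (+ k i m) ℚ./ 1))

-- The Y-frieze relation for p(f) is arithmetic: multiplying the products that define p(f)(i,m)
-- and p(f)(i,m+1) factor by factor and applying the frieze relation of f to each factor gives
-- the product of the (1 + p(f)(j,·))^{-a_{j,i}}.
--
-- For unitarity the same vertex t works. For an exchange matrix B with b_kk = 0 and positive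
-- values x, the values ŷ_j = ∏_i x_i^{b_ij} change under the A-mutation of (B, x) at k exactly
-- as (B, ŷ) does under the Y-mutation at k; B_A is skew-symmetrisable, which is inherited along
-- the tree and forces b_kk = 0. The all-ones cluster at t has all-ones ŷ, so φ_y(y(i,m)) is the
-- i-th ŷ-value at t(i,m), computed from the ψ_x-values there: f(j,m) for j ≥ i and f(j,m+1) for
-- j < i. Each mutation along t(1,m), t(2,m), … is at a sink, so the exchange matrix at t(i,m) is
-- B_A with the signs flipped between the indices below i and the others; its i-th column is
-- (-a_{j,i})_j, and so that ŷ-value is p(f)(i,m).

module Submission where

open import Defs
open import Data.Nat using (ℕ)
open import Data.Integer using (ℤ)
open import Data.Fin using (Fin)
open import Data.Product using (_×_)

open import Algebra.Bundles using (CommutativeMonoid)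
open import Data.Bool using (Bool; true; false; if_then_else_; _xor_; not)
import Data.Bool.Properties as BoolP
open import Data.Empty using (⊥-elim)
open import Data.Fin as Fin using (zero; suc; toℕ; fromℕ<; _≟_)
import Data.Fin.Properties as FinP
open import Data.Integer as ℤ using (+_; -[1+_]; +[1+_]; _⊖_)
import Data.Integer.Properties as ℤP
import Data.Integer.Tactic.RingSolver as ℤ-Ring
open import Data.List as List using (List; []; _∷_; _++_; _∷ʳ_; reverse; take; drop; concat; replicate)
import Data.List.Properties as ListP
open import Data.Nat as ℕ using (_<ᵇ_)
import Data.Nat.Coprimality as Coprimality
import Data.Nat.Properties as ℕP
open import Data.Product using (_,_; proj₁; proj₂)
open import Data.Rational as ℚ using (ℚ; mkℚ; 1ℚ; _*_; _+_; NonZero)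
import Data.Rational.Properties as ℚP
open import Data.Rational.Solver using (module +-*-Solver)
open import Data.Sum using (_⊎_; inj₁; inj₂; [_,_]′; map₂)
open import Function using (_∘_; id)
open import Relation.Binary.Definitions using (tri<; tri≈; tri>)
open import Relation.Binary.PropositionalEquality
open import Relation.Nullary using (¬_; does; yes; no)
open import Relation.Nullary.Decidable using (dec-true; dec-false)

open import Algebra.Properties.CommutativeSemigroup (CommutativeMonoid.commutativeSemigroup ℚP.*-1-commutativeMonoid)
  using (interchange)
import Algebra.Properties.CommutativeSemigroup ℕP.*-commutativeSemigroup as ℕ-*-Semigroup

open +-*-Solver using (solve; _:*_; _:=_)
open ≡-Reasoning

<ᵇ-true : ∀ {m n} → m ℕ.< n → (m <ᵇ n) ≡ true
<ᵇ-true {m} {n} m<n with m <ᵇ n | ℕP.<⇒<ᵇ m<n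
... | true | _ = refl

<ᵇ-false : ∀ {m n} → ¬ m ℕ.< n → (m <ᵇ n) ≡ false
<ᵇ-false {m} {n} m≮n with m <ᵇ n | ℕP.<ᵇ⇒< m n
... | false | _   = refl
... | true  | m<n = ⊥-elim (m≮n (m<n _))

<ᵇ-irrefl : ∀ n → (n <ᵇ n) ≡ false
<ᵇ-irrefl n = <ᵇ-false (ℕP.<-irrefl {n} refl)

<ᵇ-suc : ∀ {m n} → m ≢ n → (m <ᵇ ℕ.suc n) ≡ (m <ᵇ n)
<ᵇ-suc {ℕ.zero}  {ℕ.zero}  0≢0 = ⊥-elim (0≢0 refl)
<ᵇ-suc {ℕ.zero}  {ℕ.suc n} _   = refl
<ᵇ-suc {ℕ.suc m} {ℕ.zero}  _   = refl
<ᵇ-suc {ℕ.suc m} {ℕ.suc n} m≢n = <ᵇ-suc (m≢n ∘ cong ℕ.suc)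

[]₊-nonpos : ∀ {z} → z ℤ.≤ + 0 → [ z ]₊ ≡ 0
[]₊-nonpos {+ ℕ.zero} _ = refl
[]₊-nonpos { -[1+ _ ]} _ = refl
[]₊-nonpos {+[1+ _ ]} (ℤ.+≤+ ())

negate-if : Bool → ℤ → ℤ
negate-if c z = if c then ℤ.- z else z

negate-if-not : ∀ c z → negate-if (not c) z ≡ ℤ.- negate-if c z
negate-if-not true  z = sym (ℤP.neg-involutive z)
negate-if-not false z = refl

toℕ-≢ : ∀ {n} {p q : Fin n} → p ≢ q → toℕ p ≢ toℕ q
toℕ-≢ p≢q = p≢q ∘ FinP.toℕ-injective

-z≡∣z∣ : ∀ {z} → z ℤ.≤ + 0 → ℤ.- z ≡ + ℤ.∣ z ∣
-z≡∣z∣ {+ ℕ.zero}  _ = refl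
-z≡∣z∣ { -[1+ _ ]} _ = refl
-z≡∣z∣ {+[1+ _ ]} (ℤ.+≤+ ())

if-≟-refl : ∀ {A : Set} {n} (k : Fin n) {a b : A} → (if does (k ≟ k) then a else b) ≡ a
if-≟-refl k = cong (if_then _ else _) (dec-true (k ≟ k) refl)

if-≟-no : ∀ {A : Set} {n} {i k : Fin n} {a b : A} → i ≢ k → (if does (i ≟ k) then a else b) ≡ b
if-≟-no {i = i} {k} i≢k = cong (if_then _ else _) (dec-false (i ≟ k) i≢k)

Fin-cases : ∀ {n ℓ} {P : Fin n → Set ℓ} (k : Fin n) → P k → (∀ {i} → i ≢ k → P i) → ∀ i → P i
Fin-cases k at-k off i with i ≟ k
... | yes refl = at-k
... | no i≢k   = off i≢k

pos*pos : ∀ p q → ℚ.Positive p → ℚ.Positive q → ℚ.Positive (p * q)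
pos*pos p q p>0 q>0 = ℚP.pos*pos⇒pos p {{p>0}} q {{q>0}}

pos+pos : ∀ p q → ℚ.Positive p → ℚ.Positive q → ℚ.Positive (p + q)
pos+pos p q p>0 q>0 = ℚP.pos+pos⇒pos p {{p>0}} q {{q>0}}

inv≡1/ : ∀ p .{{_ : NonZero p}} → inv p ≡ ℚ.1/ p
inv≡1/ (mkℚ +[1+ _ ] _ _) = refl
inv≡1/ (mkℚ -[1+ _ ] _ _) = refl

inv-pos : ∀ p → ℚ.Positive p → ℚ.Positive (inv p)
inv-pos (mkℚ +[1+ _ ] _ _) _ = _

inv-inverseʳ : ∀ p → ℚ.Positive p → p * inv p ≡ 1ℚ
inv-inverseʳ p p>0 = trans (cong (p *_) (inv≡1/ p)) (ℚP.*-inverseʳ p)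
  where instance _ = ℚP.pos⇒nonZero p {{p>0}}

inv-inverseˡ : ∀ p → ℚ.Positive p → inv p * p ≡ 1ℚ
inv-inverseˡ p p>0 = trans (ℚP.*-comm (inv p) p) (inv-inverseʳ p p>0)

inv-unique : ∀ p q → ℚ.Positive p → p * q ≡ 1ℚ → q ≡ inv p
inv-unique p q p>0 pq≡1 = begin
  q                   ≡⟨ sym (ℚP.*-identityʳ q) ⟩
  q * 1ℚ              ≡⟨ cong (q *_) (sym (inv-inverseʳ p p>0)) ⟩
  q * (p * inv p)     ≡⟨ solve 3 (λ p q p⁻¹ → q :* (p :* p⁻¹) := (p :* q) :* p⁻¹) refl p q (inv p) ⟩
  (p * q) * inv p     ≡⟨ cong (_* inv p) pq≡1 ⟩
  1ℚ * inv p          ≡⟨ ℚP.*-identityˡ (inv p) ⟩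
  inv p               ∎

inv-involutive : ∀ p → ℚ.Positive p → inv (inv p) ≡ p
inv-involutive p p>0 = sym (inv-unique (inv p) p (inv-pos p p>0) (inv-inverseˡ p p>0))

inv-distrib-* : ∀ p q → ℚ.Positive p → ℚ.Positive q → inv (p * q) ≡ inv p * inv q
inv-distrib-* p q p>0 q>0 = sym (inv-unique (p * q) (inv p * inv q) (pos*pos p q p>0 q>0) (begin
  (p * q) * (inv p * inv q)       ≡⟨ interchange p q (inv p) (inv q) ⟩
  (p * inv p) * (q * inv q)       ≡⟨ cong₂ _*_ (inv-inverseʳ p p>0) (inv-inverseʳ q q>0) ⟩
  1ℚ                              ∎))

powℕ-pos : ∀ p → ℚ.Positive p → ∀ n → ℚ.Positive (powℕ p n)
powℕ-pos p p>0 ℕ.zero    = _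
powℕ-pos p p>0 (ℕ.suc n) = pos*pos p (powℕ p n) p>0 (powℕ-pos p p>0 n)

powℕ-1 : ∀ n → powℕ 1ℚ n ≡ 1ℚ
powℕ-1 ℕ.zero    = refl
powℕ-1 (ℕ.suc n) = trans (ℚP.*-identityˡ _) (powℕ-1 n)

powℕ-+ : ∀ p m n → powℕ p (m ℕ.+ n) ≡ powℕ p m * powℕ p n
powℕ-+ p ℕ.zero    n = sym (ℚP.*-identityˡ _)
powℕ-+ p (ℕ.suc m) n = trans (cong (p *_) (powℕ-+ p m n)) (sym (ℚP.*-assoc p _ _))

powℕ-distrib-* : ∀ p q n → powℕ (p * q) n ≡ powℕ p n * powℕ q n
powℕ-distrib-* p q ℕ.zero    = sym (ℚP.*-identityˡ 1ℚ)
powℕ-distrib-* p q (ℕ.suc n) =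
  trans (cong ((p * q) *_) (powℕ-distrib-* p q n)) (interchange p q (powℕ p n) (powℕ q n))

powℕ-powℕ : ∀ p m n → powℕ (powℕ p m) n ≡ powℕ p (m ℕ.* n)
powℕ-powℕ p ℕ.zero    n = powℕ-1 n
powℕ-powℕ p (ℕ.suc m) n = begin
  powℕ (p * powℕ p m) n            ≡⟨ powℕ-distrib-* p (powℕ p m) n ⟩
  powℕ p n * powℕ (powℕ p m) n     ≡⟨ cong (powℕ p n *_) (powℕ-powℕ p m n) ⟩
  powℕ p n * powℕ p (m ℕ.* n)      ≡⟨ sym (powℕ-+ p n (m ℕ.* n)) ⟩
  powℕ p (n ℕ.+ m ℕ.* n)           ∎

powℕ-inv : ∀ p → ℚ.Positive p → ∀ n → powℕ (inv p) n ≡ inv (powℕ p n)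
powℕ-inv p p>0 ℕ.zero    = refl
powℕ-inv p p>0 (ℕ.suc n) =
  trans (cong (inv p *_) (powℕ-inv p p>0 n)) (sym (inv-distrib-* p (powℕ p n) p>0 (powℕ-pos p p>0 n)))

powℤ-⊖ : ∀ p → ℚ.Positive p → ∀ u v → powℤ p (u ⊖ v) ≡ powℕ p u * inv (powℕ p v)
powℤ-⊖ p p>0 u         ℕ.zero    = sym (ℚP.*-identityʳ (powℕ p u))
powℤ-⊖ p p>0 ℕ.zero    (ℕ.suc v) = sym (ℚP.*-identityˡ _)
powℤ-⊖ p p>0 (ℕ.suc u) (ℕ.suc v) = begin
  powℤ p (ℕ.suc u ⊖ ℕ.suc v)
    ≡⟨ cong (powℤ p) (ℤP.[1+m]⊖[1+n]≡m⊖n u v) ⟩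
  powℤ p (u ⊖ v)
    ≡⟨ powℤ-⊖ p p>0 u v ⟩
  pᵘ * inv pᵛ
    ≡⟨ sym (ℚP.*-identityʳ _) ⟩
  pᵘ * inv pᵛ * 1ℚ
    ≡⟨ cong (pᵘ * inv pᵛ *_) (sym (inv-inverseʳ p p>0)) ⟩
  pᵘ * inv pᵛ * (p * inv p)
    ≡⟨ solve 4 (λ p p⁻¹ a b → a :* b :* (p :* p⁻¹) := p :* a :* (p⁻¹ :* b)) refl p (inv p) pᵘ (inv pᵛ) ⟩
  (p * pᵘ) * (inv p * inv pᵛ)
    ≡⟨ cong ((p * pᵘ) *_) (sym (inv-distrib-* p pᵛ p>0 (powℕ-pos p p>0 v))) ⟩
  powℕ p (ℕ.suc u) * inv (powℕ p (ℕ.suc v)) ∎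
  where pᵘ = powℕ p u; pᵛ = powℕ p v

[z]₊⊖[-z]₊ : ∀ z → [ z ]₊ ⊖ [ ℤ.- z ]₊ ≡ z
[z]₊⊖[-z]₊ (+ ℕ.zero)  = refl
[z]₊⊖[-z]₊ +[1+ n ]    = refl
[z]₊⊖[-z]₊ -[1+ n ]    = refl

powℤ-split : ∀ p → ℚ.Positive p → ∀ z → powℤ p z ≡ powℕ p [ z ]₊ * inv (powℕ p [ ℤ.- z ]₊)
powℤ-split p p>0 z = trans (cong (powℤ p) (sym ([z]₊⊖[-z]₊ z))) (powℤ-⊖ p p>0 [ z ]₊ [ ℤ.- z ]₊)

powℤ-pos : ∀ p → ℚ.Positive p → ∀ z → ℚ.Positive (powℤ p z)
powℤ-pos p p>0 z = subst ℚ.Positive (sym (powℤ-split p p>0 z))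
    (pos*pos (powℕ p [ z ]₊) (inv (powℕ p [ ℤ.- z ]₊))
      (powℕ-pos p p>0 [ z ]₊) (inv-pos (powℕ p [ ℤ.- z ]₊) (powℕ-pos p p>0 [ ℤ.- z ]₊)))

⊖-+-⊖ : ∀ u v u′ v′ → (u ⊖ v) ℤ.+ (u′ ⊖ v′) ≡ (u ℕ.+ u′) ⊖ (v ℕ.+ v′)
⊖-+-⊖ u v u′ v′ = begin
  (u ⊖ v) ℤ.+ (u′ ⊖ v′)                       ≡⟨ sym (cong₂ ℤ._+_ (ℤP.m-n≡m⊖n u v) (ℤP.m-n≡m⊖n u′ v′)) ⟩
  (+ u ℤ.- + v) ℤ.+ (+ u′ ℤ.- + v′)           ≡⟨ rearrange (+ u) (+ v) (+ u′) (+ v′) ⟩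
  (+ u ℤ.+ + u′) ℤ.- (+ v ℤ.+ + v′)           ≡⟨ cong₂ ℤ._-_ (sym (ℤP.pos-+ u u′)) (sym (ℤP.pos-+ v v′)) ⟩
  + (u ℕ.+ u′) ℤ.- + (v ℕ.+ v′)               ≡⟨ ℤP.m-n≡m⊖n (u ℕ.+ u′) (v ℕ.+ v′) ⟩
  (u ℕ.+ u′) ⊖ (v ℕ.+ v′)                     ∎
  where
  rearrange : ∀ a b c d → (a ℤ.- b) ℤ.+ (c ℤ.- d) ≡ (a ℤ.+ c) ℤ.- (b ℤ.+ d)
  rearrange = ℤ-Ring.solve-∀

powℤ-+ : ∀ p → ℚ.Positive p → ∀ z w → powℤ p (z ℤ.+ w) ≡ powℤ p z * powℤ p w
powℤ-+ p p>0 z w = begin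
  powℤ p (z ℤ.+ w)
    ≡⟨ cong (powℤ p) (sym (cong₂ ℤ._+_ ([z]₊⊖[-z]₊ z) ([z]₊⊖[-z]₊ w))) ⟩
  powℤ p ((u ⊖ v) ℤ.+ (u′ ⊖ v′))
    ≡⟨ cong (powℤ p) (⊖-+-⊖ u v u′ v′) ⟩
  powℤ p ((u ℕ.+ u′) ⊖ (v ℕ.+ v′))
    ≡⟨ powℤ-⊖ p p>0 (u ℕ.+ u′) (v ℕ.+ v′) ⟩
  powℕ p (u ℕ.+ u′) * inv (powℕ p (v ℕ.+ v′))
    ≡⟨ cong₂ (λ a b → a * inv b) (powℕ-+ p u u′) (powℕ-+ p v v′) ⟩
  (pᵘ * pᵘ′) * inv (pᵛ * pᵛ′)
    ≡⟨ cong ((pᵘ * pᵘ′) *_) (inv-distrib-* pᵛ pᵛ′ (powℕ-pos p p>0 v) (powℕ-pos p p>0 v′)) ⟩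
  (pᵘ * pᵘ′) * (inv pᵛ * inv pᵛ′)
    ≡⟨ interchange pᵘ pᵘ′ (inv pᵛ) (inv pᵛ′) ⟩
  (pᵘ * inv pᵛ) * (pᵘ′ * inv pᵛ′)
    ≡⟨ sym (cong₂ _*_ (powℤ-split p p>0 z) (powℤ-split p p>0 w)) ⟩
  powℤ p z * powℤ p w ∎
  where
  u = [ z ]₊; v = [ ℤ.- z ]₊; u′ = [ w ]₊; v′ = [ ℤ.- w ]₊
  pᵘ = powℕ p u; pᵛ = powℕ p v; pᵘ′ = powℕ p u′; pᵛ′ = powℕ p v′

powℤ-neg : ∀ p → ℚ.Positive p → ∀ z → powℤ p (ℤ.- z) ≡ inv (powℤ p z)
powℤ-neg p p>0 z = inv-unique (powℤ p z) (powℤ p (ℤ.- z)) (powℤ-pos p p>0 z)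
  (trans (sym (powℤ-+ p p>0 z (ℤ.- z))) (cong (powℤ p) (ℤP.+-inverseʳ z)))

powℤ-distrib-* : ∀ p q → ℚ.Positive p → ℚ.Positive q → ∀ z → powℤ (p * q) z ≡ powℤ p z * powℤ q z
powℤ-distrib-* p q p>0 q>0 z = begin
  powℤ (p * q) z
    ≡⟨ powℤ-split (p * q) (pos*pos p q p>0 q>0) z ⟩
  powℕ (p * q) u * inv (powℕ (p * q) v)
    ≡⟨ cong₂ (λ a b → a * inv b) (powℕ-distrib-* p q u) (powℕ-distrib-* p q v) ⟩
  (powℕ p u * powℕ q u) * inv (powℕ p v * powℕ q v)
    ≡⟨ cong ((powℕ p u * powℕ q u) *_) (inv-distrib-* (powℕ p v) (powℕ q v) (powℕ-pos p p>0 v) (powℕ-pos q q>0 v)) ⟩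
  (powℕ p u * powℕ q u) * (inv (powℕ p v) * inv (powℕ q v))
    ≡⟨ interchange (powℕ p u) (powℕ q u) (inv (powℕ p v)) (inv (powℕ q v)) ⟩
  (powℕ p u * inv (powℕ p v)) * (powℕ q u * inv (powℕ q v))
    ≡⟨ sym (cong₂ _*_ (powℤ-split p p>0 z) (powℤ-split q q>0 z)) ⟩
  powℤ p z * powℤ q z ∎
  where u = [ z ]₊; v = [ ℤ.- z ]₊

powℤ-1 : ∀ z → powℤ 1ℚ z ≡ 1ℚ
powℤ-1 z = trans (powℤ-split 1ℚ _ z) (cong₂ (λ a b → a * inv b) (powℕ-1 [ z ]₊) (powℕ-1 [ ℤ.- z ]₊))

powℤ-inv : ∀ p → ℚ.Positive p → ∀ z → powℤ (inv p) z ≡ inv (powℤ p z)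
powℤ-inv p p>0 z = inv-unique (powℤ p z) (powℤ (inv p) z) (powℤ-pos p p>0 z) (begin
  powℤ p z * powℤ (inv p) z      ≡⟨ sym (powℤ-distrib-* p (inv p) p>0 (inv-pos p p>0) z) ⟩
  powℤ (p * inv p) z             ≡⟨ cong (λ q → powℤ q z) (inv-inverseʳ p p>0) ⟩
  powℤ 1ℚ z                      ≡⟨ powℤ-1 z ⟩
  1ℚ                             ∎)

powℤ-inv-neg : ∀ p → ℚ.Positive p → ∀ z → powℤ (inv p) (ℤ.- z) ≡ powℤ p z
powℤ-inv-neg p p>0 z = begin
  powℤ (inv p) (ℤ.- z)      ≡⟨ powℤ-inv p p>0 (ℤ.- z) ⟩
  inv (powℤ p (ℤ.- z))      ≡⟨ cong inv (powℤ-neg p p>0 z) ⟩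
  inv (inv (powℤ p z))      ≡⟨ inv-involutive (powℤ p z) (powℤ-pos p p>0 z) ⟩
  powℤ p z                  ∎

prodℚ-cong : ∀ {n} {g h : Fin n → ℚ} → (∀ i → g i ≡ h i) → prodℚ g ≡ prodℚ h
prodℚ-cong {ℕ.zero}  g≗h = refl
prodℚ-cong {ℕ.suc n} g≗h = cong₂ _*_ (g≗h zero) (prodℚ-cong (g≗h ∘ suc))

prodℚ-* : ∀ {n} (g h : Fin n → ℚ) → prodℚ (λ i → g i * h i) ≡ prodℚ g * prodℚ h
prodℚ-* {ℕ.zero}  g h = sym (ℚP.*-identityˡ 1ℚ)
prodℚ-* {ℕ.suc n} g h = trans (cong (g zero * h zero *_) (prodℚ-* (g ∘ suc) (h ∘ suc)))
  (interchange (g zero) (h zero) (prodℚ (g ∘ suc)) (prodℚ (h ∘ suc)))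

prodℚ-1 : ∀ n → prodℚ {n} (λ _ → 1ℚ) ≡ 1ℚ
prodℚ-1 ℕ.zero    = refl
prodℚ-1 (ℕ.suc n) = trans (ℚP.*-identityˡ _) (prodℚ-1 n)

prodℚ-pos : ∀ {n} (g : Fin n → ℚ) → (∀ i → ℚ.Positive (g i)) → ℚ.Positive (prodℚ g)
prodℚ-pos {ℕ.zero}  g g>0 = _
prodℚ-pos {ℕ.suc n} g g>0 = pos*pos (g zero) (prodℚ (g ∘ suc)) (g>0 zero) (prodℚ-pos (g ∘ suc) (g>0 ∘ suc))

prodℚ-inv : ∀ {n} (g : Fin n → ℚ) → (∀ i → ℚ.Positive (g i)) → prodℚ (inv ∘ g) ≡ inv (prodℚ g)
prodℚ-inv {ℕ.zero}  g g>0 = refl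
prodℚ-inv {ℕ.suc n} g g>0 = trans (cong (inv (g zero) *_) (prodℚ-inv (g ∘ suc) (g>0 ∘ suc)))
  (sym (inv-distrib-* (g zero) (prodℚ (g ∘ suc)) (g>0 zero) (prodℚ-pos (g ∘ suc) (g>0 ∘ suc))))

prodℚ-powℕ : ∀ {n} (g : Fin n → ℚ) e → prodℚ (λ i → powℕ (g i) e) ≡ powℕ (prodℚ g) e
prodℚ-powℕ {ℕ.zero}  g e = sym (powℕ-1 e)
prodℚ-powℕ {ℕ.suc n} g e = trans (cong (powℕ (g zero) e *_) (prodℚ-powℕ (g ∘ suc) e))
  (sym (powℕ-distrib-* (g zero) (prodℚ (g ∘ suc)) e))

prodℚ-indicator : ∀ {n} (k : Fin n) c → prodℚ (λ i → if does (i ≟ k) then c else 1ℚ) ≡ c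
prodℚ-indicator {ℕ.suc n} zero    c = trans (cong (c *_) (prodℚ-1 n)) (ℚP.*-identityʳ c)
prodℚ-indicator {ℕ.suc n} (suc k) c = trans (ℚP.*-identityˡ _) (prodℚ-indicator k c)

fromℕ : ℕ → ℚ
fromℕ n = (+ n) ℚ./ 1

fromℕ-* : ∀ a b → fromℕ (a ℕ.* b) ≡ fromℕ a * fromℕ b
fromℕ-* a b = begin
  fromℕ (a ℕ.* b)             ≡⟨ cong (ℚ._/ 1) (ℤP.pos-* a b) ⟩
  (+ a ℤ.* + b) ℚ./ 1         ≡⟨⟩
  over1 a * over1 b           ≡⟨ sym (cong₂ _*_ (normalised a) (normalised b)) ⟩
  fromℕ a * fromℕ b           ∎
  where
  over1 : ℕ → ℚ
  over1 n = mkℚ (+ n) 0 (Coprimality.sym (Coprimality.1-coprimeTo n))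
  normalised : ∀ n → fromℕ n ≡ over1 n
  normalised n = ℚP.normalize-coprime (Coprimality.sym (Coprimality.1-coprimeTo n))

fromℕ-^ : ∀ a n → fromℕ (a ℕ.^ n) ≡ powℕ (fromℕ a) n
fromℕ-^ a ℕ.zero    = refl
fromℕ-^ a (ℕ.suc n) = trans (fromℕ-* a (a ℕ.^ n)) (cong (fromℕ a *_) (fromℕ-^ a n))

fromℕ-prodℕ : ∀ {n} (g : Fin n → ℕ) → fromℕ (prodℕ g) ≡ prodℚ (fromℕ ∘ g)
fromℕ-prodℕ {ℕ.zero}  g = refl
fromℕ-prodℕ {ℕ.suc n} g =
  trans (fromℕ-* (g zero) (prodℕ (g ∘ suc))) (cong (fromℕ (g zero) *_) (fromℕ-prodℕ (g ∘ suc)))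

prodℕ-cong : ∀ {n} {g h : Fin n → ℕ} → (∀ i → g i ≡ h i) → prodℕ g ≡ prodℕ h
prodℕ-cong {ℕ.zero}  g≗h = refl
prodℕ-cong {ℕ.suc n} g≗h = cong₂ ℕ._*_ (g≗h zero) (prodℕ-cong (g≗h ∘ suc))

prodℕ-* : ∀ {n} (g h : Fin n → ℕ) → prodℕ (λ i → g i ℕ.* h i) ≡ prodℕ g ℕ.* prodℕ h
prodℕ-* {ℕ.zero}  g h = refl
prodℕ-* {ℕ.suc n} g h = trans (cong (g zero ℕ.* h zero ℕ.*_) (prodℕ-* (g ∘ suc) (h ∘ suc)))
  (ℕ-*-Semigroup.interchange (g zero) (h zero) (prodℕ (g ∘ suc)) (prodℕ (h ∘ suc)))

prodℕ-pos : ∀ {n} (g : Fin n → ℕ) → (∀ i → 0 ℕ.< g i) → 0 ℕ.< prodℕ g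
prodℕ-pos {ℕ.zero}  g g>0 = ℕP.0<1+n
prodℕ-pos {ℕ.suc n} g g>0 = ℕP.*-mono-< (g>0 zero) (prodℕ-pos (g ∘ suc) (g>0 ∘ suc))

^-distrib-* : ∀ a b e → (a ℕ.* b) ℕ.^ e ≡ a ℕ.^ e ℕ.* b ℕ.^ e
^-distrib-* a b ℕ.zero    = refl
^-distrib-* a b (ℕ.suc e) = trans (cong (a ℕ.* b ℕ.*_) (^-distrib-* a b e))
  (ℕ-*-Semigroup.interchange a b (a ℕ.^ e) (b ℕ.^ e))

twoProdFactor : ∀ {r} → Mat r → Fin r → Fin r → ℕ → ℕ → ℕ
twoProdFactor A i j a b =
  if toℕ i <ᵇ toℕ j then a ℕ.^ ℤ.∣ A j i ∣
  else if toℕ j <ᵇ toℕ i then b ℕ.^ ℤ.∣ A j i ∣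
  else 1

twoProdFactor-* : ∀ {r} (A : Mat r) i j a b a′ b′ →
  twoProdFactor A i j a b ℕ.* twoProdFactor A i j a′ b′ ≡ twoProdFactor A i j (a ℕ.* a′) (b ℕ.* b′)
twoProdFactor-* A i j a b a′ b′ with toℕ i <ᵇ toℕ j | toℕ j <ᵇ toℕ i
... | true  | _     = sym (^-distrib-* a a′ ℤ.∣ A j i ∣)
... | false | true  = sym (^-distrib-* b b′ ℤ.∣ A j i ∣)
... | false | false = refl

twoProdFactor-pos : ∀ {r} (A : Mat r) i j {a b} → 0 ℕ.< a → 0 ℕ.< b → 0 ℕ.< twoProdFactor A i j a b
twoProdFactor-pos A i j {a} {b} a>0 b>0 with toℕ i <ᵇ toℕ j | toℕ j <ᵇ toℕ i
... | true  | _     = ℕP.m^n>0 a {{ℕ.>-nonZero a>0}} ℤ.∣ A j i ∣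
... | false | true  = ℕP.m^n>0 b {{ℕ.>-nonZero b>0}} ℤ.∣ A j i ∣
... | false | false = ℕP.0<1+n

twoProdFactor-< : ∀ {r} (A : Mat r) {i j} a b → toℕ i ℕ.< toℕ j → twoProdFactor A i j a b ≡ a ℕ.^ ℤ.∣ A j i ∣
twoProdFactor-< A a b i<j rewrite <ᵇ-true i<j = refl

twoProdFactor-> : ∀ {r} (A : Mat r) {i j} a b → toℕ j ℕ.< toℕ i → twoProdFactor A i j a b ≡ b ℕ.^ ℤ.∣ A j i ∣
twoProdFactor-> A a b j<i rewrite <ᵇ-false (ℕP.<⇒≯ j<i) | <ᵇ-true j<i = refl

twoProdFactor-diag : ∀ {r} (A : Mat r) i a b → twoProdFactor A i i a b ≡ 1
twoProdFactor-diag A i a b rewrite <ᵇ-irrefl (toℕ i) = refl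

pAS-isYFrieze : ∀ {r} (A : Mat r) (f : Fin r → ℤ → ℕ) → IsFrieze A f → IsYFrieze A (pAS A f)
pAS-isYFrieze A f (f>0 , exchange) = k>0 , k-exchange
  where
  k>0 : Positive (pAS A f)
  k>0 i m = prodℕ-pos _ (λ j → twoProdFactor-pos A i j (f>0 j m) (f>0 j (m ℤ.+ + 1)))
  k-exchange : ∀ i m → pAS A f i m ℕ.* pAS A f i (m ℤ.+ + 1)
             ≡ twoProd A (λ j → 1 ℕ.+ pAS A f j m) (λ j → 1 ℕ.+ pAS A f j (m ℤ.+ + 1)) i
  k-exchange i m = begin
    pAS A f i m ℕ.* pAS A f i m′
      ≡⟨ sym (prodℕ-* (λ j → F j (f j m) (f j m′)) (λ j → F j (f j m′) (f j m″))) ⟩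
    prodℕ (λ j → F j (f j m) (f j m′) ℕ.* F j (f j m′) (f j m″))
      ≡⟨ prodℕ-cong (λ j → twoProdFactor-* A i j _ _ _ _) ⟩
    prodℕ (λ j → F j (f j m ℕ.* f j m′) (f j m′ ℕ.* f j m″))
      ≡⟨ prodℕ-cong (λ j → cong₂ (F j) (exchange j m) (exchange j m′)) ⟩
    prodℕ (λ j → F j (1 ℕ.+ pAS A f j m) (1 ℕ.+ pAS A f j m′)) ∎
    where
    m′ = m ℤ.+ + 1
    m″ = m′ ℤ.+ + 1
    F = twoProdFactor A i

-- Mutation and the map ŷ

module _ {r} (k : Fin r) (B : Mat r) where

  μB-row : ∀ j → μB k B k j ≡ ℤ.- B k j
  μB-row j = if-≟-refl k

  μB-col : ∀ i → μB k B i k ≡ ℤ.- B i k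
  μB-col i with i ≟ k
  ... | yes _ = refl
  ... | no  _ = if-≟-refl k

  μB-off : ∀ {i j} → i ≢ k → j ≢ k →
    μB k B i j ≡ B i j ℤ.+ + ([ B i k ]₊ ℕ.* [ B k j ]₊) ℤ.- + ([ ℤ.- B i k ]₊ ℕ.* [ ℤ.- B k j ]₊)
  μB-off i≢k j≢k = trans (if-≟-no i≢k) (if-≟-no j≢k)

  monomial⁺ monomial⁻ : (Fin r → ℚ) → ℚ
  monomial⁺ x = prodℚ (λ l → powℕ (x l) [ B l k ]₊)
  monomial⁻ x = prodℚ (λ l → powℕ (x l) [ ℤ.- B l k ]₊)

  μA-at : ∀ x → proj₂ (μA k (B , x)) k ≡ (monomial⁺ x + monomial⁻ x) * inv (x k)
  μA-at x = if-≟-refl k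

  μA-off : ∀ x {j} → j ≢ k → proj₂ (μA k (B , x)) j ≡ x j
  μA-off x j≢k = if-≟-no j≢k

  μY-at : ∀ y → proj₂ (μY k (B , y)) k ≡ inv (y k)
  μY-at y = if-≟-refl k

  μY-off : ∀ y {j} → j ≢ k → proj₂ (μY k (B , y)) j ≡ y j * powℕ (y k) [ B k j ]₊ * powℤ (1ℚ + y k) (ℤ.- B k j)
  μY-off y j≢k = if-≟-no j≢k

  monomial⁺-pos : ∀ x → (∀ i → ℚ.Positive (x i)) → ℚ.Positive (monomial⁺ x)
  monomial⁺-pos x x>0 = prodℚ-pos _ (λ l → powℕ-pos (x l) (x>0 l) [ B l k ]₊)

  monomial⁻-pos : ∀ x → (∀ i → ℚ.Positive (x i)) → ℚ.Positive (monomial⁻ x)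
  monomial⁻-pos x x>0 = prodℚ-pos _ (λ l → powℕ-pos (x l) (x>0 l) [ ℤ.- B l k ]₊)

  μA-pos : ∀ x → (∀ i → ℚ.Positive (x i)) → ∀ i → ℚ.Positive (proj₂ (μA k (B , x)) i)
  μA-pos x x>0 i with i ≟ k
  ... | yes refl = pos*pos (monomial⁺ x + monomial⁻ x) (inv (x k))
    (pos+pos (monomial⁺ x) (monomial⁻ x) (monomial⁺-pos x x>0) (monomial⁻-pos x x>0)) (inv-pos (x k) (x>0 k))
  ... | no _     = x>0 i

ŷ : ∀ {r} → Mat r → (Fin r → ℚ) → Fin r → ℚ
ŷ B x j = prodℚ (λ i → powℤ (x i) (B i j))

ŷ-split : ∀ {r} (k : Fin r) B x → (∀ i → ℚ.Positive (x i)) → ŷ B x k ≡ monomial⁺ k B x * inv (monomial⁻ k B x)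
ŷ-split k B x x>0 = begin
  prodℚ (λ i → powℤ (x i) (B i k))
    ≡⟨ prodℚ-cong (λ i → powℤ-split (x i) (x>0 i) (B i k)) ⟩
  prodℚ (λ i → powℕ (x i) [ B i k ]₊ * inv (powℕ (x i) [ ℤ.- B i k ]₊))
    ≡⟨ prodℚ-* (λ i → powℕ (x i) [ B i k ]₊) (λ i → inv (powℕ (x i) [ ℤ.- B i k ]₊)) ⟩
  monomial⁺ k B x * prodℚ (λ i → inv (powℕ (x i) [ ℤ.- B i k ]₊))
    ≡⟨ cong (monomial⁺ k B x *_) (prodℚ-inv _ (λ i → powℕ-pos (x i) (x>0 i) [ ℤ.- B i k ]₊)) ⟩
  monomial⁺ k B x * inv (monomial⁻ k B x) ∎

y-exchange-factor : ∀ P M b → ℚ.Positive P → ℚ.Positive M →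
  powℕ P [ b ]₊ * inv (powℕ M [ ℤ.- b ]₊) * powℤ (P + M) (ℤ.- b)
  ≡ powℕ (P * inv M) [ b ]₊ * powℤ (1ℚ + P * inv M) (ℤ.- b)
y-exchange-factor P M b P>0 M>0 = begin
  Pᵘ * inv Mᵛ * D
    ≡⟨ sym (ℚP.*-identityʳ _) ⟩
  Pᵘ * inv Mᵛ * D * 1ℚ
    ≡⟨ cong (Pᵘ * inv Mᵛ * D *_) (sym (inv-inverseˡ Mᵘ (powℕ-pos M M>0 u))) ⟩
  Pᵘ * inv Mᵛ * D * (inv Mᵘ * Mᵘ)
    ≡⟨ solve 5 (λ a b c d e → a :* b :* c :* (d :* e) := (a :* d) :* (c :* (e :* b))) refl Pᵘ (inv Mᵛ) D (inv Mᵘ) Mᵘ ⟩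
  (Pᵘ * inv Mᵘ) * (D * (Mᵘ * inv Mᵛ))
    ≡⟨ cong₂ (λ a c → (Pᵘ * a) * (D * c)) (sym (powℕ-inv M M>0 u)) (sym (powℤ-split M M>0 b)) ⟩
  (Pᵘ * powℕ (inv M) u) * (D * powℤ M b)
    ≡⟨ cong₂ (λ a c → a * (D * c)) (sym (powℕ-distrib-* P (inv M) u)) (sym (powℤ-inv-neg M M>0 b)) ⟩
  powℕ (P * inv M) u * (D * powℤ (inv M) (ℤ.- b))
    ≡⟨ cong (powℕ (P * inv M) u *_)
         (sym (powℤ-distrib-* (P + M) (inv M) (pos+pos P M P>0 M>0) (inv-pos M M>0) (ℤ.- b))) ⟩
  powℕ (P * inv M) u * powℤ ((P + M) * inv M) (ℤ.- b)
    ≡⟨ cong (λ q → powℕ (P * inv M) u * powℤ q (ℤ.- b)) [P+M]/M ⟩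
  powℕ (P * inv M) u * powℤ (1ℚ + P * inv M) (ℤ.- b) ∎
  where
  u = [ b ]₊; v = [ ℤ.- b ]₊
  Pᵘ = powℕ P u; Mᵘ = powℕ M u; Mᵛ = powℕ M v
  D = powℤ (P + M) (ℤ.- b)
  [P+M]/M : (P + M) * inv M ≡ 1ℚ + P * inv M
  [P+M]/M = trans (ℚP.*-distribʳ-+ (inv M) P M)
    (trans (cong (λ q → P * inv M + q) (inv-inverseʳ M M>0)) (ℚP.+-comm (P * inv M) 1ℚ))

powℤ-shift : ∀ p → ℚ.Positive p → ∀ z n n′ → powℤ p (z ℤ.+ + n ℤ.- + n′) ≡ powℤ p z * powℕ p n * inv (powℕ p n′)
powℤ-shift p p>0 z n n′ =
  trans (powℤ-+ p p>0 (z ℤ.+ + n) (ℤ.- + n′)) (cong₂ _*_ (powℤ-+ p p>0 z (+ n)) (powℤ-neg p p>0 (+ n′)))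

module _ {r} (k : Fin r) (B : Mat r) (B-kk : B k k ≡ + 0) (x : Fin r → ℚ) (x>0 : ∀ i → ℚ.Positive (x i)) where

  private
    x′ = proj₂ (μA k (B , x))
    P = monomial⁺ k B x
    M = monomial⁻ k B x

    P>0 : ℚ.Positive P
    P>0 = monomial⁺-pos k B x x>0

    M>0 : ℚ.Positive M
    M>0 = monomial⁻-pos k B x x>0

  ŷ-μ-at : ŷ (μB k B) x′ k ≡ inv (ŷ B x k)
  ŷ-μ-at = trans (prodℚ-cong factor) (prodℚ-inv (λ i → powℤ (x i) (B i k)) (λ i → powℤ-pos (x i) (x>0 i) (B i k)))
    where
    factor : ∀ i → powℤ (x′ i) (μB k B i k) ≡ inv (powℤ (x i) (B i k))
    factor = Fin-cases k
      (trans (cong (powℤ (x′ k)) (trans (μB-col k B k) (cong ℤ.-_ B-kk)))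
             (cong (λ z → inv (powℤ (x k) z)) (sym B-kk)))
      (λ {i} i≢k → trans (cong₂ powℤ (μA-off k B x i≢k) (μB-col k B i)) (powℤ-neg (x i) (x>0 i) (B i k)))

  module _ {j} (j≢k : j ≢ k) where

    private
      b = B k j
      u = [ b ]₊
      v = [ ℤ.- b ]₊
      D = powℤ (P + M) (ℤ.- b)

      T₁ T₂ T₃ T δ : Fin r → ℚ
      T₁ i = powℤ (x i) (B i j)
      T₂ i = powℕ (powℕ (x i) [ B i k ]₊) u
      T₃ i = powℕ (powℕ (x i) [ ℤ.- B i k ]₊) v
      T i = T₁ i * T₂ i * inv (T₃ i)
      δ i = if does (i ≟ k) then D else 1ℚ

      T-at : T k ≡ powℤ (x k) b
      T-at = begin
        T k
          ≡⟨ cong (λ z → T₁ k * powℕ (powℕ (x k) [ z ]₊) u * inv (powℕ (powℕ (x k) [ ℤ.- z ]₊) v)) B-kk ⟩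
        T₁ k * powℕ 1ℚ u * inv (powℕ 1ℚ v)
          ≡⟨ cong₂ (λ c d → T₁ k * c * inv d) (powℕ-1 u) (powℕ-1 v) ⟩
        T₁ k * 1ℚ * 1ℚ
          ≡⟨ trans (ℚP.*-identityʳ _) (ℚP.*-identityʳ _) ⟩
        powℤ (x k) b ∎

      factor-at : powℤ (x′ k) (μB k B k j) ≡ T k * δ k
      factor-at = begin
        powℤ (x′ k) (μB k B k j)
          ≡⟨ cong₂ powℤ (μA-at k B x) (μB-row k B j) ⟩
        powℤ ((P + M) * inv (x k)) (ℤ.- b)
          ≡⟨ powℤ-distrib-* (P + M) (inv (x k)) (pos+pos P M P>0 M>0) (inv-pos (x k) (x>0 k)) (ℤ.- b) ⟩
        D * powℤ (inv (x k)) (ℤ.- b)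
          ≡⟨ cong (D *_) (powℤ-inv-neg (x k) (x>0 k) b) ⟩
        D * powℤ (x k) b
          ≡⟨ ℚP.*-comm D (powℤ (x k) b) ⟩
        powℤ (x k) b * D
          ≡⟨ cong₂ _*_ (sym T-at) (sym (if-≟-refl k)) ⟩
        T k * δ k ∎

      factor-off : ∀ {i} → i ≢ k → powℤ (x′ i) (μB k B i j) ≡ T i * δ i
      factor-off {i} i≢k = begin
        powℤ (x′ i) (μB k B i j)
          ≡⟨ cong₂ powℤ (μA-off k B x i≢k) (μB-off k B i≢k j≢k) ⟩
        powℤ (x i) (B i j ℤ.+ + ([ B i k ]₊ ℕ.* u) ℤ.- + ([ ℤ.- B i k ]₊ ℕ.* v))
          ≡⟨ powℤ-shift (x i) (x>0 i) (B i j) ([ B i k ]₊ ℕ.* u) ([ ℤ.- B i k ]₊ ℕ.* v) ⟩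
        T₁ i * powℕ (x i) ([ B i k ]₊ ℕ.* u) * inv (powℕ (x i) ([ ℤ.- B i k ]₊ ℕ.* v))
          ≡⟨ cong₂ (λ c d → T₁ i * c * inv d)
               (sym (powℕ-powℕ (x i) [ B i k ]₊ u)) (sym (powℕ-powℕ (x i) [ ℤ.- B i k ]₊ v)) ⟩
        T i
          ≡⟨ sym (ℚP.*-identityʳ (T i)) ⟩
        T i * 1ℚ
          ≡⟨ cong (T i *_) (sym (if-≟-no i≢k)) ⟩
        T i * δ i ∎

      prodℚ-T : prodℚ T ≡ ŷ B x j * powℕ P u * inv (powℕ M v)
      prodℚ-T = begin
        prodℚ T
          ≡⟨ prodℚ-* (λ i → T₁ i * T₂ i) (inv ∘ T₃) ⟩
        prodℚ (λ i → T₁ i * T₂ i) * prodℚ (inv ∘ T₃)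
          ≡⟨ cong₂ _*_ (prodℚ-* T₁ T₂) (prodℚ-inv T₃ (λ i → powℕ-pos _ (powℕ-pos (x i) (x>0 i) [ ℤ.- B i k ]₊) v)) ⟩
        ŷ B x j * prodℚ T₂ * inv (prodℚ T₃)
          ≡⟨ cong₂ (λ c d → ŷ B x j * c * inv d)
               (prodℚ-powℕ (λ i → powℕ (x i) [ B i k ]₊) u) (prodℚ-powℕ (λ i → powℕ (x i) [ ℤ.- B i k ]₊) v) ⟩
        ŷ B x j * powℕ P u * inv (powℕ M v) ∎

    ŷ-μ-off : ŷ (μB k B) x′ j ≡ ŷ B x j * powℕ (ŷ B x k) u * powℤ (1ℚ + ŷ B x k) (ℤ.- b)
    ŷ-μ-off = begin
      prodℚ (λ i → powℤ (x′ i) (μB k B i j))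
        ≡⟨ prodℚ-cong (Fin-cases k factor-at factor-off) ⟩
      prodℚ (λ i → T i * δ i)
        ≡⟨ prodℚ-* T δ ⟩
      prodℚ T * prodℚ δ
        ≡⟨ cong₂ _*_ prodℚ-T (prodℚ-indicator k D) ⟩
      ŷ B x j * powℕ P u * inv (powℕ M v) * D
        ≡⟨ solve 4 (λ a b c d → a :* b :* c :* d := a :* (b :* c :* d)) refl (ŷ B x j) (powℕ P u) (inv (powℕ M v)) D ⟩
      ŷ B x j * (powℕ P u * inv (powℕ M v) * D)
        ≡⟨ cong (ŷ B x j *_) (y-exchange-factor P M b P>0 M>0) ⟩
      ŷ B x j * (powℕ (P * inv M) u * powℤ (1ℚ + P * inv M) (ℤ.- b))
        ≡⟨ sym (ℚP.*-assoc (ŷ B x j) _ _) ⟩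
      ŷ B x j * powℕ (P * inv M) u * powℤ (1ℚ + P * inv M) (ℤ.- b)
        ≡⟨ cong (λ y → ŷ B x j * powℕ y u * powℤ (1ℚ + y) (ℤ.- b)) (sym (ŷ-split k B x x>0)) ⟩
      ŷ B x j * powℕ (ŷ B x k) u * powℤ (1ℚ + ŷ B x k) (ℤ.- b) ∎

  ŷ-μ : ∀ j → ŷ (μB k B) x′ j ≡ proj₂ (μY k (B , ŷ B x)) j
  ŷ-μ = Fin-cases k (trans ŷ-μ-at (sym (μY-at k B (ŷ B x))))
    (λ j≢k → trans (ŷ-μ-off j≢k) (sym (μY-off k B (ŷ B x) j≢k)))

ŷ-allOne : ∀ {r} (B : Mat r) j → ŷ B allOne j ≡ 1ℚ
ŷ-allOne {r} B j = trans (prodℚ-cong (λ i → powℤ-1 (B i j))) (prodℚ-1 r)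

-- Skew-symmetrisers

SkewSymmetrisedBy : ∀ {r} → (Fin r → ℕ) → Mat r → Set
SkewSymmetrisedBy d B = ∀ i j → + d i ℤ.* B i j ≡ ℤ.- (+ d j ℤ.* B j i)

skew⇒diagonal-zero : ∀ {r} {d : Fin r → ℕ} {B : Mat r} → (∀ i → 0 ℕ.< d i) → SkewSymmetrisedBy d B → ∀ i → B i i ≡ + 0
skew⇒diagonal-zero {d = d} {B} d>0 skew i =
  ℤP.*-cancelˡ-≡ (+ d i) (B i i) (+ 0) {{ℕ.>-nonZero (d>0 i)}}
    (trans (self-negating (skew i i)) (sym (ℤP.*-zeroʳ (+ d i))))
  where
  self-negating : ∀ {z} → z ≡ ℤ.- z → z ≡ + 0
  self-negating {+ ℕ.zero} _ = refl
  self-negating {+[1+ _ ]} ()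
  self-negating { -[1+ _ ]} ()

[+d*z]₊ : ∀ d z → [ + d ℤ.* z ]₊ ≡ d ℕ.* [ z ]₊
[+d*z]₊ d (+ n)    = cong [_]₊ (sym (ℤP.pos-* d n))
[+d*z]₊ d -[1+ n ] = begin
  [ + d ℤ.* -[1+ n ] ]₊              ≡⟨ cong [_]₊ (sym (ℤP.neg-distribʳ-* (+ d) (+ ℕ.suc n))) ⟩
  [ ℤ.- (+ d ℤ.* + ℕ.suc n) ]₊       ≡⟨ cong (λ z → [ ℤ.- z ]₊) (sym (ℤP.pos-* d (ℕ.suc n))) ⟩
  [ ℤ.- + (d ℕ.* ℕ.suc n) ]₊         ≡⟨ [-n]₊ (d ℕ.* ℕ.suc n) ⟩
  0                                  ≡⟨ sym (ℕP.*-zeroʳ d) ⟩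
  d ℕ.* 0                            ∎
  where
  [-n]₊ : ∀ n → [ ℤ.- + n ]₊ ≡ 0
  [-n]₊ ℕ.zero    = refl
  [-n]₊ (ℕ.suc _) = refl

module _ {r} (d : Fin r → ℕ) (B : Mat r) (skew : SkewSymmetrisedBy d B) where

  skew-neg : ∀ i j → + d i ℤ.* ℤ.- B i j ≡ ℤ.- (+ d j ℤ.* ℤ.- B j i)
  skew-neg i j = begin
    + d i ℤ.* ℤ.- B i j               ≡⟨ sym (ℤP.neg-distribʳ-* (+ d i) (B i j)) ⟩
    ℤ.- (+ d i ℤ.* B i j)             ≡⟨ cong ℤ.-_ (skew i j) ⟩
    ℤ.- (ℤ.- (+ d j ℤ.* B j i))       ≡⟨ cong ℤ.-_ (ℤP.neg-distribʳ-* (+ d j) (B j i)) ⟩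
    ℤ.- (+ d j ℤ.* ℤ.- B j i)         ∎

  skew-[]₊ : ∀ i j → d i ℕ.* [ B i j ]₊ ≡ d j ℕ.* [ ℤ.- B j i ]₊
  skew-[]₊ i j = begin
    d i ℕ.* [ B i j ]₊                 ≡⟨ sym ([+d*z]₊ (d i) (B i j)) ⟩
    [ + d i ℤ.* B i j ]₊               ≡⟨ cong [_]₊ (skew i j) ⟩
    [ ℤ.- (+ d j ℤ.* B j i) ]₊         ≡⟨ cong [_]₊ (ℤP.neg-distribʳ-* (+ d j) (B j i)) ⟩
    [ + d j ℤ.* ℤ.- B j i ]₊           ≡⟨ [+d*z]₊ (d j) (ℤ.- B j i) ⟩
    d j ℕ.* [ ℤ.- B j i ]₊             ∎

  skew-[-]₊ : ∀ i j → d i ℕ.* [ ℤ.- B i j ]₊ ≡ d j ℕ.* [ B j i ]₊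
  skew-[-]₊ i j = begin
    d i ℕ.* [ ℤ.- B i j ]₊                 ≡⟨ sym ([+d*z]₊ (d i) (ℤ.- B i j)) ⟩
    [ + d i ℤ.* ℤ.- B i j ]₊               ≡⟨ cong [_]₊ (skew-neg i j) ⟩
    [ ℤ.- (+ d j ℤ.* ℤ.- B j i) ]₊         ≡⟨ cong [_]₊ (ℤP.neg-distribʳ-* (+ d j) (ℤ.- B j i)) ⟩
    [ + d j ℤ.* ℤ.- ℤ.- B j i ]₊           ≡⟨ [+d*z]₊ (d j) (ℤ.- ℤ.- B j i) ⟩
    d j ℕ.* [ ℤ.- ℤ.- B j i ]₊             ≡⟨ cong (λ z → d j ℕ.* [ z ]₊) (ℤP.neg-involutive (B j i)) ⟩
    d j ℕ.* [ B j i ]₊                     ∎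

skew-chain : ∀ d₁ d₂ d₃ p q u v → d₁ ℕ.* p ≡ d₂ ℕ.* u → d₂ ℕ.* q ≡ d₃ ℕ.* v → d₁ ℕ.* (p ℕ.* q) ≡ d₃ ℕ.* (v ℕ.* u)
skew-chain d₁ d₂ d₃ p q u v e₁ e₂ = begin
  d₁ ℕ.* (p ℕ.* q)      ≡⟨ sym (ℕP.*-assoc d₁ p q) ⟩
  d₁ ℕ.* p ℕ.* q        ≡⟨ cong (ℕ._* q) e₁ ⟩
  d₂ ℕ.* u ℕ.* q        ≡⟨ ℕ-*-Semigroup.xy∙z≈y∙xz d₂ u q ⟩
  u ℕ.* (d₂ ℕ.* q)      ≡⟨ cong (u ℕ.*_) e₂ ⟩
  u ℕ.* (d₃ ℕ.* v)      ≡⟨ ℕ-*-Semigroup.x∙yz≈y∙zx u d₃ v ⟩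
  d₃ ℕ.* (v ℕ.* u)      ∎

μB-skew : ∀ {r} (d : Fin r → ℕ) k B → SkewSymmetrisedBy d B → SkewSymmetrisedBy d (μB k B)
μB-skew d k B skew = Fin-cases k row (λ i≢k → Fin-cases k (column i≢k) (off i≢k))
  where
  row : ∀ j → + d k ℤ.* μB k B k j ≡ ℤ.- (+ d j ℤ.* μB k B j k)
  row j = trans (cong (+ d k ℤ.*_) (μB-row k B j))
         (trans (skew-neg d B skew k j) (cong (λ z → ℤ.- (+ d j ℤ.* z)) (sym (μB-col k B j))))

  column : ∀ {i} → i ≢ k → + d i ℤ.* μB k B i k ≡ ℤ.- (+ d k ℤ.* μB k B k i)
  column {i} _ = trans (cong (+ d i ℤ.*_) (μB-col k B i))
         (trans (skew-neg d B skew i k) (cong (λ z → ℤ.- (+ d k ℤ.* z)) (sym (μB-row k B i))))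

  off : ∀ {i} → i ≢ k → ∀ {j} → j ≢ k → + d i ℤ.* μB k B i j ≡ ℤ.- (+ d j ℤ.* μB k B j i)
  off {i} i≢k {j} j≢k = begin
    + d i ℤ.* μB k B i j
      ≡⟨ cong (+ d i ℤ.*_) (μB-off k B i≢k j≢k) ⟩
    + d i ℤ.* (B i j ℤ.+ + a ℤ.- + c)
      ≡⟨ distribute (+ d i) (B i j) (+ a) (+ c) ⟩
    + d i ℤ.* B i j ℤ.+ + d i ℤ.* + a ℤ.- + d i ℤ.* + c
      ≡⟨ cong₂ (λ s t → + d i ℤ.* B i j ℤ.+ s ℤ.- t)
           (trans (sym (ℤP.pos-* (d i) a)) (cong +_ a≡c′)) (trans (sym (ℤP.pos-* (d i) c)) (cong +_ c≡a′)) ⟩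
    + d i ℤ.* B i j ℤ.+ + (d j ℕ.* c′) ℤ.- + (d j ℕ.* a′)
      ≡⟨ cong₂ (λ s t → s ℤ.+ + (d j ℕ.* c′) ℤ.- t) (skew i j) (ℤP.pos-* (d j) a′) ⟩
    ℤ.- (+ d j ℤ.* B j i) ℤ.+ + (d j ℕ.* c′) ℤ.- + d j ℤ.* + a′
      ≡⟨ cong (λ s → ℤ.- (+ d j ℤ.* B j i) ℤ.+ s ℤ.- + d j ℤ.* + a′) (ℤP.pos-* (d j) c′) ⟩
    ℤ.- (+ d j ℤ.* B j i) ℤ.+ + d j ℤ.* + c′ ℤ.- + d j ℤ.* + a′
      ≡⟨ collect (+ d j) (B j i) (+ a′) (+ c′) ⟩
    ℤ.- (+ d j ℤ.* (B j i ℤ.+ + a′ ℤ.- + c′))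
      ≡⟨ cong (λ z → ℤ.- (+ d j ℤ.* z)) (sym (μB-off k B j≢k i≢k)) ⟩
    ℤ.- (+ d j ℤ.* μB k B j i) ∎
    where
    a = [ B i k ]₊ ℕ.* [ B k j ]₊
    c = [ ℤ.- B i k ]₊ ℕ.* [ ℤ.- B k j ]₊
    a′ = [ B j k ]₊ ℕ.* [ B k i ]₊
    c′ = [ ℤ.- B j k ]₊ ℕ.* [ ℤ.- B k i ]₊
    a≡c′ : d i ℕ.* a ≡ d j ℕ.* c′
    a≡c′ = skew-chain (d i) (d k) (d j) [ B i k ]₊ [ B k j ]₊ [ ℤ.- B k i ]₊ [ ℤ.- B j k ]₊
             (skew-[]₊ d B skew i k) (skew-[]₊ d B skew k j)
    c≡a′ : d i ℕ.* c ≡ d j ℕ.* a′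
    c≡a′ = skew-chain (d i) (d k) (d j) [ ℤ.- B i k ]₊ [ ℤ.- B k j ]₊ [ B k i ]₊ [ B j k ]₊
             (skew-[-]₊ d B skew i k) (skew-[-]₊ d B skew k j)
    distribute : ∀ δ b s t → δ ℤ.* (b ℤ.+ s ℤ.- t) ≡ δ ℤ.* b ℤ.+ δ ℤ.* s ℤ.- δ ℤ.* t
    distribute = ℤ-Ring.solve-∀
    collect : ∀ δ b s t → ℤ.- (δ ℤ.* b) ℤ.+ δ ℤ.* t ℤ.- δ ℤ.* s ≡ ℤ.- (δ ℤ.* (b ℤ.+ s ℤ.- t))
    collect = ℤ-Ring.solve-∀

matAt-skew : ∀ {r} (d : Fin r → ℕ) w B → SkewSymmetrisedBy d B → SkewSymmetrisedBy d (matAt B w)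
matAt-skew d []      B skew = skew
matAt-skew d (k ∷ w) B skew = matAt-skew d w (μB k B) (μB-skew d k B skew)

μY-cong : ∀ {r} (k : Fin r) B {y y′ : Fin r → ℚ} → (∀ j → y j ≡ y′ j) →
  ∀ j → proj₂ (μY k (B , y)) j ≡ proj₂ (μY k (B , y′)) j
μY-cong k B y≗y′ j =
  cong₂ (λ a b → if does (j ≟ k) then inv b else a * powℕ b [ B k j ]₊ * powℤ (1ℚ + b) (ℤ.- B k j)) (y≗y′ j) (y≗y′ k)

ŷ-mutAlong : ∀ {r} (d : Fin r → ℕ) → (∀ i → 0 ℕ.< d i) → ∀ w B → SkewSymmetrisedBy d B →
  ∀ x → (∀ i → ℚ.Positive (x i)) → ∀ y → (∀ j → y j ≡ ŷ B x j) →
  ∀ j → proj₂ (mutAlong μY w (B , y)) j ≡ ŷ (matAt B w) (proj₂ (mutAlong μA w (B , x))) j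
ŷ-mutAlong d d>0 []      B skew x x>0 y y≗ŷ = y≗ŷ
ŷ-mutAlong d d>0 (k ∷ w) B skew x x>0 y y≗ŷ =
  ŷ-mutAlong d d>0 w (μB k B) (μB-skew d k B skew) (proj₂ (μA k (B , x))) (μA-pos k B x x>0) (proj₂ (μY k (B , y)))
    (λ j → trans (μY-cong k B y≗ŷ j) (sym (ŷ-μ k B (skew⇒diagonal-zero d>0 skew k) x x>0 j)))

-- Exchange matrices along the path

infix 4 _≋_
_≋_ : ∀ {r} → Mat r → Mat r → Set
B ≋ C = ∀ i j → B i j ≡ C i j

≋-reflexive : ∀ {r} {B C : Mat r} → B ≡ C → B ≋ C
≋-reflexive refl i j = refl

≋-sym : ∀ {r} {B C : Mat r} → B ≋ C → C ≋ B
≋-sym B≋C i j = sym (B≋C i j)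

≋-trans : ∀ {r} {B C D : Mat r} → B ≋ C → C ≋ D → B ≋ D
≋-trans B≋C C≋D i j = trans (B≋C i j) (C≋D i j)

μB-cong : ∀ {r} (k : Fin r) {B C : Mat r} → B ≋ C → μB k B ≋ μB k C
μB-cong k {B} {C} B≋C i j = cong₃ (B≋C i j) (B≋C i k) (B≋C k j)
  where
  cong₃ : ∀ {b c b′ c′ b″ c″} → b ≡ c → b′ ≡ c′ → b″ ≡ c″ →
    (if does (i ≟ k) then ℤ.- b else if does (j ≟ k) then ℤ.- b
     else b ℤ.+ + ([ b′ ]₊ ℕ.* [ b″ ]₊) ℤ.- + ([ ℤ.- b′ ]₊ ℕ.* [ ℤ.- b″ ]₊))
    ≡ (if does (i ≟ k) then ℤ.- c else if does (j ≟ k) then ℤ.- c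
     else c ℤ.+ + ([ c′ ]₊ ℕ.* [ c″ ]₊) ℤ.- + ([ ℤ.- c′ ]₊ ℕ.* [ ℤ.- c″ ]₊))
  cong₃ refl refl refl = refl

matAt-cong : ∀ {r} w {B C : Mat r} → B ≋ C → matAt B w ≋ matAt C w
matAt-cong []      B≋C = B≋C
matAt-cong (k ∷ w) B≋C = matAt-cong w (μB-cong k B≋C)

matAt-++ : ∀ {r} (B : Mat r) u v → matAt B (u ++ v) ≡ matAt (matAt B u) v
matAt-++ B u v = ListP.foldl-++ (λ B′ k → μB k B′) B u v

matAt-∷ʳ : ∀ {r} (B : Mat r) u k → matAt B (u ∷ʳ k) ≡ μB k (matAt B u)
matAt-∷ʳ B u k = ListP.foldl-∷ʳ (λ B′ k → μB k B′) B k u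

μB-involutive : ∀ {r} (k : Fin r) B → μB k (μB k B) ≋ B
μB-involutive k B = Fin-cases k row (λ i≢k → Fin-cases k (column i≢k) (off i≢k))
  where
  row : ∀ j → μB k (μB k B) k j ≡ B k j
  row j = trans (μB-row k (μB k B) j) (trans (cong ℤ.-_ (μB-row k B j)) (ℤP.neg-involutive (B k j)))

  column : ∀ {i} → i ≢ k → μB k (μB k B) i k ≡ B i k
  column {i} _ = trans (μB-col k (μB k B) i) (trans (cong ℤ.-_ (μB-col k B i)) (ℤP.neg-involutive (B i k)))

  off : ∀ {i} → i ≢ k → ∀ {j} → j ≢ k → μB k (μB k B) i j ≡ B i j
  off {i} i≢k {j} j≢k = begin
    μB k (μB k B) i j
      ≡⟨ μB-off k (μB k B) i≢k j≢k ⟩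
    μB k B i j ℤ.+ + ([ μB k B i k ]₊ ℕ.* [ μB k B k j ]₊) ℤ.- + ([ ℤ.- μB k B i k ]₊ ℕ.* [ ℤ.- μB k B k j ]₊)
      ≡⟨ cong₂ (λ s t → μB k B i j ℤ.+ + ([ s ]₊ ℕ.* [ t ]₊) ℤ.- + ([ ℤ.- s ]₊ ℕ.* [ ℤ.- t ]₊))
           (μB-col k B i) (μB-row k B j) ⟩
    μB k B i j ℤ.+ + c ℤ.- + ([ ℤ.- ℤ.- B i k ]₊ ℕ.* [ ℤ.- ℤ.- B k j ]₊)
      ≡⟨ cong₂ (λ s t → μB k B i j ℤ.+ + c ℤ.- + ([ s ]₊ ℕ.* [ t ]₊))
           (ℤP.neg-involutive (B i k)) (ℤP.neg-involutive (B k j)) ⟩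
    μB k B i j ℤ.+ + c ℤ.- + a
      ≡⟨ cong (λ s → s ℤ.+ + c ℤ.- + a) (μB-off k B i≢k j≢k) ⟩
    B i j ℤ.+ + a ℤ.- + c ℤ.+ + c ℤ.- + a
      ≡⟨ cancel (B i j) (+ a) (+ c) ⟩
    B i j ∎
    where
    a = [ B i k ]₊ ℕ.* [ B k j ]₊
    c = [ ℤ.- B i k ]₊ ℕ.* [ ℤ.- B k j ]₊
    cancel : ∀ b s t → b ℤ.+ s ℤ.- t ℤ.+ t ℤ.- s ≡ b
    cancel = ℤ-Ring.solve-∀

matAt-reverse : ∀ {r} w (B : Mat r) → matAt (matAt B w) (reverse w) ≋ B
matAt-reverse []      B = ≋-reflexive refl
matAt-reverse (k ∷ w) B =
  ≋-trans (≋-reflexive (trans (cong (matAt (matAt (μB k B) w)) (ListP.unfold-reverse k w))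
                              (matAt-∷ʳ (matAt (μB k B) w) (reverse w) k)))
          (≋-trans (μB-cong k (matAt-reverse w (μB k B))) (μB-involutive k B))

matAt-replicate : ∀ {r} (B : Mat r) w → matAt B w ≋ B → ∀ n → matAt B (concat (replicate n w)) ≋ B
matAt-replicate B w periodic ℕ.zero    = ≋-reflexive refl
matAt-replicate B w periodic (ℕ.suc n) = ≋-trans (≋-reflexive (matAt-++ B w (concat (replicate n w))))
  (≋-trans (matAt-cong (concat (replicate n w)) periodic) (matAt-replicate B w periodic n))

μB-sink : ∀ {r} (k : Fin r) B → (∀ {q} → q ≢ k → [ B k q ]₊ ≡ 0) → (∀ {p} → p ≢ k → [ ℤ.- B p k ]₊ ≡ 0) →
  ∀ {p q} → p ≢ k → q ≢ k → μB k B p q ≡ B p q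
μB-sink k B row≤0 column≥0 {p} {q} p≢k q≢k = begin
  μB k B p q
    ≡⟨ μB-off k B p≢k q≢k ⟩
  B p q ℤ.+ + ([ B p k ]₊ ℕ.* [ B k q ]₊) ℤ.- + ([ ℤ.- B p k ]₊ ℕ.* [ ℤ.- B k q ]₊)
    ≡⟨ cong₂ (λ s t → B p q ℤ.+ + s ℤ.- + t)
         (trans (cong ([ B p k ]₊ ℕ.*_) (row≤0 q≢k)) (ℕP.*-zeroʳ [ B p k ]₊))
         (cong (ℕ._* [ ℤ.- B k q ]₊) (column≥0 p≢k)) ⟩
  B p q ℤ.+ + 0 ℤ.- + 0
    ≡⟨ trans (ℤP.+-identityʳ _) (ℤP.+-identityʳ _) ⟩
  B p q ∎

path : ∀ {r} → ℕ → ℤ → List (Fin r)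
path {r} a (+ n)    = concat (replicate n (List.allFin r)) ++ take a (List.allFin r)
path {r} a -[1+ n ] = concat (replicate n (reverse (List.allFin r))) ++ reverse (drop a (List.allFin r))

pathTo≡path : ∀ {r} (i : Fin r) m → pathTo i m ≡ path (toℕ i) m
pathTo≡path i (+ n)    = refl
pathTo≡path i -[1+ n ] = refl

concat-replicate-comm : ∀ {X : Set} n (w : List X) → concat (replicate n w) ++ w ≡ w ++ concat (replicate n w)
concat-replicate-comm ℕ.zero    w = sym (ListP.++-identityʳ w)
concat-replicate-comm (ℕ.suc n) w =
  trans (ListP.++-assoc w (concat (replicate n w)) w) (cong (w ++_) (concat-replicate-comm n w))

drop-tabulate : ∀ {n} {X : Set} (f : Fin n → X) i →
  drop (toℕ i) (List.tabulate f) ≡ f i ∷ drop (ℕ.suc (toℕ i)) (List.tabulate f)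
drop-tabulate f zero    = refl
drop-tabulate f (suc i) = drop-tabulate (f ∘ suc) i

module _ {r : ℕ} where

  private
    L = List.allFin r

  length-allFin : List.length L ≡ r
  length-allFin = ListP.length-tabulate id

  take-suc-allFin : ∀ (ℓ : Fin r) {a} → toℕ ℓ ≡ a → take (ℕ.suc a) L ≡ take a L ∷ʳ ℓ
  take-suc-allFin ℓ refl = ListP.take-suc-tabulate id ℓ

  drop-allFin : ∀ (ℓ : Fin r) {a} → toℕ ℓ ≡ a → drop a L ≡ ℓ ∷ drop (ℕ.suc a) L
  drop-allFin ℓ refl = drop-tabulate id ℓ

  path-r : ∀ m → path {r} r m ≡ path 0 (m ℤ.+ + 1)
  path-r (+ n) = begin
    concat (replicate n L) ++ take r L
      ≡⟨ cong (concat (replicate n L) ++_) (ListP.take-all r L (ℕP.≤-reflexive length-allFin)) ⟩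
    concat (replicate n L) ++ L
      ≡⟨ concat-replicate-comm n L ⟩
    L ++ concat (replicate n L)
      ≡⟨ sym (ListP.++-identityʳ _) ⟩
    concat (replicate (ℕ.suc n) L) ++ []
      ≡⟨ cong (λ n′ → concat (replicate n′ L) ++ []) (ℕP.+-comm 1 n) ⟩
    concat (replicate (n ℕ.+ 1) L) ++ [] ∎
  path-r -[1+ ℕ.zero ] = cong reverse (ListP.drop-all r L (ℕP.≤-reflexive length-allFin))
  path-r -[1+ ℕ.suc n ] = begin
    concat (replicate (ℕ.suc n) (reverse L)) ++ reverse (drop r L)
      ≡⟨ cong (λ w → concat (replicate (ℕ.suc n) (reverse L)) ++ reverse w)
           (ListP.drop-all r L (ℕP.≤-reflexive length-allFin)) ⟩
    concat (replicate (ℕ.suc n) (reverse L)) ++ []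
      ≡⟨ ListP.++-identityʳ _ ⟩
    reverse L ++ concat (replicate n (reverse L))
      ≡⟨ sym (concat-replicate-comm n (reverse L)) ⟩
    concat (replicate n (reverse L)) ++ reverse L ∎

Adjacent : ∀ {r} → Fin r → List (Fin r) → List (Fin r) → Set
Adjacent ℓ u v = v ≡ u ∷ʳ ℓ ⊎ u ≡ v ∷ʳ ℓ

Adjacent-++ : ∀ {r} {ℓ : Fin r} pre {u v} → Adjacent ℓ u v → Adjacent ℓ (pre ++ u) (pre ++ v)
Adjacent-++ {ℓ = ℓ} pre {u} (inj₁ refl) = inj₁ (sym (ListP.++-assoc pre u (ℓ ∷ [])))
Adjacent-++ {ℓ = ℓ} pre {v = v} (inj₂ refl) = inj₂ (sym (ListP.++-assoc pre v (ℓ ∷ [])))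

path-adjacent : ∀ {r} (ℓ : Fin r) {a} → toℕ ℓ ≡ a → ∀ m → Adjacent ℓ (path a m) (path (ℕ.suc a) m)
path-adjacent {r} ℓ {a} ℓ≡a (+ n) = Adjacent-++ (concat (replicate n (List.allFin r))) (inj₁ (take-suc-allFin ℓ ℓ≡a))
path-adjacent {r} ℓ {a} ℓ≡a -[1+ n ] = Adjacent-++ (concat (replicate n (reverse (List.allFin r))))
  (inj₂ (trans (cong reverse (drop-allFin ℓ ℓ≡a)) (ListP.unfold-reverse ℓ (drop (ℕ.suc a) (List.allFin r)))))

module _ {r} (A : Mat r) where

  BA-< : ∀ {p q} → toℕ p ℕ.< toℕ q → BA A p q ≡ A p q
  BA-< p<q rewrite <ᵇ-true p<q = refl

  BA-> : ∀ {p q} → toℕ q ℕ.< toℕ p → BA A p q ≡ ℤ.- A p q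
  BA-> q<p rewrite <ᵇ-false (ℕP.<⇒≯ q<p) | <ᵇ-true q<p = refl

  BA-diag : ∀ p → BA A p p ≡ + 0
  BA-diag p rewrite <ᵇ-irrefl (toℕ p) = refl

module _ {r} (A : Mat r) (gcm : IsSymGCM r A) where

  open IsSymGCM gcm

  private
    d = proj₁ symmetrisable

  BA-skew : SkewSymmetrisedBy d (BA A)
  BA-skew i j with ℕP.<-cmp (toℕ i) (toℕ j)
  ... | tri< i<j _ _ = begin
    + d i ℤ.* BA A i j               ≡⟨ cong (+ d i ℤ.*_) (BA-< A i<j) ⟩
    + d i ℤ.* A i j                  ≡⟨ proj₂ (proj₂ symmetrisable) i j ⟩
    + d j ℤ.* A j i                  ≡⟨ sym (ℤP.neg-involutive _) ⟩
    ℤ.- ℤ.- (+ d j ℤ.* A j i)        ≡⟨ cong ℤ.-_ (ℤP.neg-distribʳ-* (+ d j) (A j i)) ⟩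
    ℤ.- (+ d j ℤ.* ℤ.- A j i)        ≡⟨ cong (λ z → ℤ.- (+ d j ℤ.* z)) (sym (BA-> A i<j)) ⟩
    ℤ.- (+ d j ℤ.* BA A j i)         ∎
  ... | tri≈ _ i≡j _ = subst (λ j → + d i ℤ.* BA A i j ≡ ℤ.- (+ d j ℤ.* BA A j i)) (FinP.toℕ-injective i≡j) diagonal
    where
    diagonal : + d i ℤ.* BA A i i ≡ ℤ.- (+ d i ℤ.* BA A i i)
    diagonal rewrite BA-diag A i | ℤP.*-zeroʳ (+ d i) = refl
  ... | tri> _ _ j<i = begin
    + d i ℤ.* BA A i j               ≡⟨ cong (+ d i ℤ.*_) (BA-> A j<i) ⟩
    + d i ℤ.* ℤ.- A i j              ≡⟨ sym (ℤP.neg-distribʳ-* (+ d i) (A i j)) ⟩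
    ℤ.- (+ d i ℤ.* A i j)            ≡⟨ cong ℤ.-_ (proj₂ (proj₂ symmetrisable) i j) ⟩
    ℤ.- (+ d j ℤ.* A j i)            ≡⟨ cong (λ z → ℤ.- (+ d j ℤ.* z)) (sym (BA-< A j<i)) ⟩
    ℤ.- (+ d j ℤ.* BA A j i)         ∎

module _ {r} (A : Mat r) (offdiag : ∀ i j → i ≢ j → A i j ℤ.≤ + 0) where

  private
    L = List.allFin r

  -- The exchange matrix at the end of path a m (the vertex t(a+1, m), indices being 0-based), for
  -- every m: the mutations at the indices below a flip exactly the entries coupling an index below
  -- a with one at or above a.
  B-at : ℕ → Mat r
  B-at a p q = negate-if ((toℕ p <ᵇ a) xor (toℕ q <ᵇ a)) (BA A p q)

  B-at-≡ : ∀ a p q {c} → ((toℕ p <ᵇ a) xor (toℕ q <ᵇ a)) ≡ c → B-at a p q ≡ negate-if c (BA A p q)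
  B-at-≡ a p q = cong (λ c → negate-if c (BA A p q))

  B-at-diag : ∀ a p → B-at a p p ≡ + 0
  B-at-diag a p = trans (B-at-≡ a p p (BoolP.xor-same (toℕ p <ᵇ a))) (BA-diag A p)

  B-at-r : B-at r ≋ BA A
  B-at-r p q = B-at-≡ r p q (cong₂ _xor_ (<ᵇ-true (FinP.toℕ<n p)) (<ᵇ-true (FinP.toℕ<n q)))

  B-at-row : ∀ {k q} → q ≢ k → B-at (toℕ k) k q ≡ A k q
  B-at-row {k} {q} q≢k with ℕP.<-cmp (toℕ q) (toℕ k)
  ... | tri< q<k _ _ = trans (B-at-≡ (toℕ k) k q (cong₂ _xor_ (<ᵇ-irrefl (toℕ k)) (<ᵇ-true q<k)))
                             (trans (cong ℤ.-_ (BA-> A q<k)) (ℤP.neg-involutive (A k q)))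
  ... | tri≈ _ q≡k _ = ⊥-elim (toℕ-≢ q≢k q≡k)
  ... | tri> _ _ k<q = trans (B-at-≡ (toℕ k) k q (cong₂ _xor_ (<ᵇ-irrefl (toℕ k)) (<ᵇ-false (ℕP.<⇒≯ k<q))))
                             (BA-< A k<q)

  B-at-column : ∀ {k p} → p ≢ k → B-at (toℕ k) p k ≡ ℤ.- A p k
  B-at-column {k} {p} p≢k with ℕP.<-cmp (toℕ p) (toℕ k)
  ... | tri< p<k _ _ = trans (B-at-≡ (toℕ k) p k (cong₂ _xor_ (<ᵇ-true p<k) (<ᵇ-irrefl (toℕ k))))
                             (cong ℤ.-_ (BA-< A p<k))
  ... | tri≈ _ p≡k _ = ⊥-elim (toℕ-≢ p≢k p≡k)
  ... | tri> _ _ k<p = trans (B-at-≡ (toℕ k) p k (cong₂ _xor_ (<ᵇ-false (ℕP.<⇒≯ k<p)) (<ᵇ-irrefl (toℕ k))))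
                             (BA-> A k<p)

  B-at-column-∣∣ : ∀ {k p} → p ≢ k → B-at (toℕ k) p k ≡ + ℤ.∣ A p k ∣
  B-at-column-∣∣ {k} {p} p≢k = trans (B-at-column p≢k) (-z≡∣z∣ (offdiag p k p≢k))

  B-at-suc-row : ∀ k q → B-at (ℕ.suc (toℕ k)) k q ≡ ℤ.- B-at (toℕ k) k q
  B-at-suc-row k = Fin-cases k (trans (B-at-diag (ℕ.suc (toℕ k)) k) (sym (cong ℤ.-_ (B-at-diag (toℕ k) k)))) off
    where
    off : ∀ {q} → q ≢ k → B-at (ℕ.suc (toℕ k)) k q ≡ ℤ.- B-at (toℕ k) k q
    off {q} q≢k = begin
      B-at (ℕ.suc (toℕ k)) k q
        ≡⟨ B-at-≡ (ℕ.suc (toℕ k)) k q (cong₂ _xor_ (<ᵇ-true (ℕP.n<1+n (toℕ k))) (<ᵇ-suc (toℕ-≢ q≢k))) ⟩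
      negate-if (not (toℕ q <ᵇ toℕ k)) (BA A k q)
        ≡⟨ negate-if-not (toℕ q <ᵇ toℕ k) (BA A k q) ⟩
      ℤ.- negate-if (toℕ q <ᵇ toℕ k) (BA A k q)
        ≡⟨ cong ℤ.-_ (sym (B-at-≡ (toℕ k) k q (cong (_xor (toℕ q <ᵇ toℕ k)) (<ᵇ-irrefl (toℕ k))))) ⟩
      ℤ.- B-at (toℕ k) k q ∎

  B-at-suc-column : ∀ {k p} → p ≢ k → B-at (ℕ.suc (toℕ k)) p k ≡ ℤ.- B-at (toℕ k) p k
  B-at-suc-column {k} {p} p≢k = begin
    B-at (ℕ.suc (toℕ k)) p k
      ≡⟨ B-at-≡ (ℕ.suc (toℕ k)) p k
           (trans (cong₂ _xor_ (<ᵇ-suc (toℕ-≢ p≢k)) (<ᵇ-true (ℕP.n<1+n (toℕ k)))) (xor-true c)) ⟩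
    negate-if (not c) (BA A p k)
      ≡⟨ negate-if-not c (BA A p k) ⟩
    ℤ.- negate-if c (BA A p k)
      ≡⟨ cong ℤ.-_ (sym (B-at-≡ (toℕ k) p k (trans (cong (c xor_) (<ᵇ-irrefl (toℕ k))) (BoolP.xor-identityʳ c)))) ⟩
    ℤ.- B-at (toℕ k) p k ∎
    where
    c = toℕ p <ᵇ toℕ k
    xor-true : ∀ b → b xor true ≡ not b
    xor-true b = trans (BoolP.xor-comm b true) (BoolP.true-xor b)

  B-at-suc-off : ∀ {k p q} → p ≢ k → q ≢ k → B-at (ℕ.suc (toℕ k)) p q ≡ B-at (toℕ k) p q
  B-at-suc-off {k} {p} {q} p≢k q≢k =
    B-at-≡ (ℕ.suc (toℕ k)) p q (cong₂ _xor_ (<ᵇ-suc (toℕ-≢ p≢k)) (<ᵇ-suc (toℕ-≢ q≢k)))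

  μB-B-at : ∀ k {a} → toℕ k ≡ a → μB k (B-at a) ≋ B-at (ℕ.suc a)
  μB-B-at k refl = Fin-cases k row (λ p≢k → Fin-cases k (column p≢k) (off p≢k))
    where
    row : ∀ q → μB k (B-at (toℕ k)) k q ≡ B-at (ℕ.suc (toℕ k)) k q
    row q = trans (μB-row k (B-at (toℕ k)) q) (sym (B-at-suc-row k q))

    column : ∀ {p} → p ≢ k → μB k (B-at (toℕ k)) p k ≡ B-at (ℕ.suc (toℕ k)) p k
    column {p} p≢k = trans (μB-col k (B-at (toℕ k)) p) (sym (B-at-suc-column p≢k))

    row≤0 : ∀ {q} → q ≢ k → [ B-at (toℕ k) k q ]₊ ≡ 0
    row≤0 {q} q≢k = trans (cong [_]₊ (B-at-row q≢k)) ([]₊-nonpos (offdiag k q (q≢k ∘ sym)))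

    column≥0 : ∀ {p} → p ≢ k → [ ℤ.- B-at (toℕ k) p k ]₊ ≡ 0
    column≥0 {p} p≢k = trans (cong (λ z → [ ℤ.- z ]₊) (B-at-column p≢k))
      (trans (cong [_]₊ (ℤP.neg-involutive (A p k))) ([]₊-nonpos (offdiag p k p≢k)))

    off : ∀ {p} → p ≢ k → ∀ {q} → q ≢ k → μB k (B-at (toℕ k)) p q ≡ B-at (ℕ.suc (toℕ k)) p q
    off p≢k q≢k = trans (μB-sink k (B-at (toℕ k)) row≤0 column≥0 p≢k q≢k) (sym (B-at-suc-off p≢k q≢k))

  matAt-take : ∀ a → a ℕ.≤ r → matAt (BA A) (take a L) ≋ B-at a
  matAt-take ℕ.zero    _   = ≋-reflexive refl
  matAt-take (ℕ.suc a) a<r =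
    ≋-trans (≋-reflexive (trans (cong (matAt (BA A)) (take-suc-allFin ℓ ℓ≡a)) (matAt-∷ʳ (BA A) (take a L) ℓ)))
            (≋-trans (μB-cong ℓ (matAt-take a (ℕP.<⇒≤ a<r))) (μB-B-at ℓ ℓ≡a))
    where
    ℓ = fromℕ< a<r
    ℓ≡a = FinP.toℕ-fromℕ< a<r

  matAt-allFin : matAt (BA A) L ≋ BA A
  matAt-allFin = ≋-trans (≋-reflexive (cong (matAt (BA A)) (sym (ListP.take-all r L (ℕP.≤-reflexive length-allFin)))))
                         (≋-trans (matAt-take r ℕP.≤-refl) B-at-r)

  matAt-reverse-allFin : matAt (BA A) (reverse L) ≋ BA A
  matAt-reverse-allFin = ≋-trans (matAt-cong (reverse L) (≋-sym matAt-allFin)) (matAt-reverse L (BA A))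

  matAt-reverse-drop : ∀ a → a ℕ.≤ r → matAt (BA A) (reverse (drop a L)) ≋ B-at a
  matAt-reverse-drop a a≤r =
    ≋-trans (matAt-cong (reverse (drop a L)) (≋-sym rest≋BA)) (matAt-reverse (drop a L) (B-at a))
    where
    rest≋BA : matAt (B-at a) (drop a L) ≋ BA A
    rest≋BA = ≋-trans (matAt-cong (drop a L) (≋-sym (matAt-take a a≤r)))
      (≋-trans (≋-reflexive (trans (sym (matAt-++ (BA A) (take a L) (drop a L)))
                                   (cong (matAt (BA A)) (ListP.take++drop≡id a L))))
               matAt-allFin)

  matAt-path : ∀ a → a ℕ.≤ r → ∀ m → matAt (BA A) (path a m) ≋ B-at a
  matAt-path a a≤r (+ n) = ≋-trans (≋-reflexive (matAt-++ (BA A) (concat (replicate n L)) (take a L)))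
    (≋-trans (matAt-cong (take a L) (matAt-replicate (BA A) L matAt-allFin n)) (matAt-take a a≤r))
  matAt-path a a≤r -[1+ n ] =
    ≋-trans (≋-reflexive (matAt-++ (BA A) (concat (replicate n (reverse L))) (reverse (drop a L))))
      (≋-trans (matAt-cong (reverse (drop a L)) (matAt-replicate (BA A) (reverse L) matAt-reverse-allFin n))
               (matAt-reverse-drop a a≤r))

  matAt-vertex : ∀ t a → a ℕ.≤ r → ∀ m → matAt (matAt (BA A) t) (reverse t ++ path a m) ≋ B-at a
  matAt-vertex t a a≤r m = ≋-trans (≋-reflexive (matAt-++ (matAt (BA A) t) (reverse t) (path a m)))
    (≋-trans (matAt-cong (path a m) (matAt-reverse t (BA A))) (matAt-path a a≤r m))

mutAlong-∷ʳ-off : ∀ {r} (s : Seed r) w ℓ {j} → j ≢ ℓ → proj₂ (mutAlong μA (w ∷ʳ ℓ) s) j ≡ proj₂ (mutAlong μA w s) j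
mutAlong-∷ʳ-off s w ℓ {j} j≢ℓ = trans (cong (λ s′ → proj₂ s′ j) (ListP.foldl-∷ʳ (λ s′ k → μA k s′) s ℓ w))
  (μA-off ℓ (proj₁ (mutAlong μA w s)) (proj₂ (mutAlong μA w s)) j≢ℓ)

Adjacent-off : ∀ {r} (s : Seed r) {ℓ u v j} → Adjacent ℓ u v → j ≢ ℓ →
  proj₂ (mutAlong μA u s) j ≡ proj₂ (mutAlong μA v s) j
Adjacent-off s {ℓ} {u} (inj₁ refl) j≢ℓ = sym (mutAlong-∷ʳ-off s u ℓ j≢ℓ)
Adjacent-off s {ℓ} {v = v} (inj₂ refl) j≢ℓ = mutAlong-∷ʳ-off s v ℓ j≢ℓ

module _ {r} (s : Seed r) (pre : List (Fin r)) where

  clusterAt : ℕ → ℤ → Fin r → ℚ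
  clusterAt a m = proj₂ (mutAlong μA (pre ++ path a m) s)

  clusterAt-suc : ∀ {a} → a ℕ.< r → ∀ m {j} → toℕ j ≢ a → clusterAt a m j ≡ clusterAt (ℕ.suc a) m j
  clusterAt-suc a<r m j≢a =
    Adjacent-off s (Adjacent-++ pre (path-adjacent ℓ ℓ≡a m)) (λ j≡ℓ → j≢a (trans (cong toℕ j≡ℓ) ℓ≡a))
    where
    ℓ = fromℕ< a<r
    ℓ≡a = FinP.toℕ-fromℕ< a<r

  clusterAt-walk : ∀ d a m {j} → d ℕ.+ a ℕ.≤ r → toℕ j ℕ.< a ⊎ d ℕ.+ a ℕ.≤ toℕ j →
    clusterAt a m j ≡ clusterAt (d ℕ.+ a) m j
  clusterAt-walk ℕ.zero    a m _ _ = refl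
  clusterAt-walk (ℕ.suc d) a m {j} d+a<r outside =
    trans (clusterAt-walk d a m (ℕP.<⇒≤ d+a<r) (map₂ ℕP.<⇒≤ outside)) (clusterAt-suc d+a<r m j≢d+a)
    where
    j≢d+a : toℕ j ≢ d ℕ.+ a
    j≢d+a = [ (λ j<a → ℕP.<⇒≢ (ℕP.<-≤-trans j<a (ℕP.m≤n+m a d))) , (λ d+a<j → ≢-sym (ℕP.<⇒≢ d+a<j)) ]′ outside

  clusterAt-wrap : ∀ m j → clusterAt r m j ≡ clusterAt 0 (m ℤ.+ + 1) j
  clusterAt-wrap m j = cong (λ w → proj₂ (mutAlong μA (pre ++ w) s) j) (path-r m)

-- Unitarity

module _ {r} (A : Mat r) (gcm : IsSymGCM r A) (f : Fin r → ℤ → ℕ) (t : List (Fin r))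
         (unit : ∀ i m → ψx (BA A) t i m ≡ fromℕ (f i m)) where

  open IsSymGCM gcm

  private
    s₀ : Seed r
    s₀ = matAt (BA A) t , allOne

    x : ℕ → ℤ → Fin r → ℚ
    x = clusterAt s₀ (reverse t)

  x-diagonal : ∀ j m → x (toℕ j) m j ≡ fromℕ (f j m)
  x-diagonal j m = trans (cong (λ w → proj₂ (mutAlong μA (reverse t ++ w) s₀) j) (sym (pathTo≡path j m))) (unit j m)

  x-≤ : ∀ {a j} m → a ℕ.≤ toℕ j → x a m j ≡ fromℕ (f j m)
  x-≤ {a} {j} m a≤j = begin
    x a m j
      ≡⟨ clusterAt-walk s₀ (reverse t) (toℕ j ℕ.∸ a) a m bound (inj₂ (ℕP.≤-reflexive d+a≡j)) ⟩
    x (toℕ j ℕ.∸ a ℕ.+ a) m j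
      ≡⟨ cong (λ b → x b m j) d+a≡j ⟩
    x (toℕ j) m j
      ≡⟨ x-diagonal j m ⟩
    fromℕ (f j m) ∎
    where
    d+a≡j = ℕP.m∸n+n≡m a≤j
    bound = subst (ℕ._≤ r) (sym d+a≡j) (ℕP.<⇒≤ (FinP.toℕ<n j))

  x-> : ∀ {i j} m → toℕ j ℕ.< toℕ i → x (toℕ i) m j ≡ fromℕ (f j (m ℤ.+ + 1))
  x-> {i} {j} m j<i = begin
    x (toℕ i) m j
      ≡⟨ clusterAt-walk s₀ (reverse t) (r ℕ.∸ toℕ i) (toℕ i) m (ℕP.≤-reflexive d+i≡r) (inj₁ j<i) ⟩
    x (r ℕ.∸ toℕ i ℕ.+ toℕ i) m j
      ≡⟨ cong (λ b → x b m j) d+i≡r ⟩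
    x r m j
      ≡⟨ clusterAt-wrap s₀ (reverse t) m j ⟩
    x 0 (m ℤ.+ + 1) j
      ≡⟨ x-≤ (m ℤ.+ + 1) ℕ.z≤n ⟩
    fromℕ (f j (m ℤ.+ + 1)) ∎
    where d+i≡r = ℕP.m∸n+n≡m (ℕP.<⇒≤ (FinP.toℕ<n i))

  ŷ-factor : ∀ i m j →
    powℤ (x (toℕ i) m j) (B-at A offdiag (toℕ i) j i) ≡ fromℕ (twoProdFactor A i j (f j m) (f j (m ℤ.+ + 1)))
  ŷ-factor i m j with ℕP.<-cmp (toℕ i) (toℕ j)
  ... | tri< i<j _ _ = begin
    powℤ (x (toℕ i) m j) (B-at A offdiag (toℕ i) j i)
      ≡⟨ cong₂ powℤ (x-≤ m (ℕP.<⇒≤ i<j)) (B-at-column-∣∣ A offdiag (λ j≡i → ℕP.<-irrefl (cong toℕ (sym j≡i)) i<j)) ⟩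
    powℕ (fromℕ (f j m)) ℤ.∣ A j i ∣
      ≡⟨ sym (fromℕ-^ (f j m) ℤ.∣ A j i ∣) ⟩
    fromℕ (f j m ℕ.^ ℤ.∣ A j i ∣)
      ≡⟨ cong fromℕ (sym (twoProdFactor-< A (f j m) (f j (m ℤ.+ + 1)) i<j)) ⟩
    fromℕ (twoProdFactor A i j (f j m) (f j (m ℤ.+ + 1))) ∎
  ... | tri≈ _ i≡j _ with FinP.toℕ-injective i≡j
  ...   | refl = trans (cong (powℤ (x (toℕ i) m i)) (B-at-diag A offdiag (toℕ i) i))
                       (cong fromℕ (sym (twoProdFactor-diag A i (f i m) (f i (m ℤ.+ + 1)))))
  ŷ-factor i m j | tri> _ _ j<i = begin
    powℤ (x (toℕ i) m j) (B-at A offdiag (toℕ i) j i)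
      ≡⟨ cong₂ powℤ (x-> m j<i) (B-at-column-∣∣ A offdiag (λ j≡i → ℕP.<-irrefl (cong toℕ j≡i) j<i)) ⟩
    powℕ (fromℕ (f j (m ℤ.+ + 1))) ℤ.∣ A j i ∣
      ≡⟨ sym (fromℕ-^ (f j (m ℤ.+ + 1)) ℤ.∣ A j i ∣) ⟩
    fromℕ (f j (m ℤ.+ + 1) ℕ.^ ℤ.∣ A j i ∣)
      ≡⟨ cong fromℕ (sym (twoProdFactor-> A (f j m) (f j (m ℤ.+ + 1)) j<i)) ⟩
    fromℕ (twoProdFactor A i j (f j m) (f j (m ℤ.+ + 1))) ∎

  pAS-unitary : ∀ i m → φy (BA A) t i m ≡ fromℕ (pAS A f i m)
  pAS-unitary i m = begin
    φy (BA A) t i m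
      ≡⟨ ŷ-mutAlong d d>0 w M₀ (matAt-skew d t (BA A) (BA-skew A gcm))
           allOne (λ _ → _) allOne (λ j → sym (ŷ-allOne M₀ j)) i ⟩
    ŷ (matAt M₀ w) (proj₂ (mutAlong μA w s₀)) i
      ≡⟨ prodℚ-cong (λ j → cong₂ powℤ (values j) (matrix j)) ⟩
    prodℚ (λ j → powℤ (x (toℕ i) m j) (B-at A offdiag (toℕ i) j i))
      ≡⟨ prodℚ-cong (ŷ-factor i m) ⟩
    prodℚ (λ j → fromℕ (twoProdFactor A i j (f j m) (f j (m ℤ.+ + 1))))
      ≡⟨ sym (fromℕ-prodℕ (λ j → twoProdFactor A i j (f j m) (f j (m ℤ.+ + 1)))) ⟩
    fromℕ (pAS A f i m) ∎
    where
    d = proj₁ symmetrisable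
    d>0 = proj₁ (proj₂ symmetrisable)
    M₀ = matAt (BA A) t
    w = reverse t ++ pathTo i m
    values : ∀ j → proj₂ (mutAlong μA w s₀) j ≡ x (toℕ i) m j
    values j = cong (λ p → proj₂ (mutAlong μA (reverse t ++ p) s₀) j) (pathTo≡path i m)
    matrix : ∀ j → matAt M₀ w j i ≡ B-at A offdiag (toℕ i) j i
    matrix j = trans (cong (λ p → matAt M₀ (reverse t ++ p) j i) (pathTo≡path i m))
                     (matAt-vertex A offdiag t (toℕ i) (ℕP.<⇒≤ (FinP.toℕ<n i)) m j i)

theorem2p15 : (r : ℕ) (A : Fin r → Fin r → ℤ) → IsSymGCM r A →
    (f : Fin r → ℤ → ℕ) → IsFrieze A f → UnitaryFrieze A f →
    IsYFrieze A (pAS A f) × UnitaryYFrieze A (pAS A f)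
theorem2p15 r A gcm f frieze (t , reduced , unitary) =
  pAS-isYFrieze A f frieze , (t , reduced , pAS-unitary A gcm f t unitary)
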